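{- Let $G$ be a balanced bipartite graph with bipartition $(X,Y)$ and let $S\subseteq X$. Let $C=x_1y_1x_2y_2\cdots x_my_mx_1$ be a cycle of $G$ with $x_i\in X$, $y_i\in Y$, and $|C|=2m\ge 6$, and let $x,y$ be two vertices of $G-C$ with $x\in S$ and $y\in Y$. Suppose that $C$ is a minimal system of $G$, i.e. $|V(C)\cap S|\ge 2$ and $G$ has no cycle $C'$ with $|V(C')\cap S|\ge 2$ and $|C'|<|C|$. Then: (1) $d_C(x)\le 2$ and $d_C(y)\le 4$; moreover, $e(\{x,y\},C)\le 4$ if $xy\in E(G)$. (2) $d_C(y)\le \frac{1}{2}|C|-1$. In particular, if $d_C(y)=\frac12|C|-1$ and $X_C\setminus N_C(y)=\{x_j\}$, then $x_j\in S$, $|S_C|=2$, $|C|\le 8$, and $S_C=\{x_j,x_{j+2}\}$ if $|C|=8$ (indices taken modulo $m$). (3) If $e(\{x,y\},C)\ge \frac12|C|+1$, then $xy\notin E(G)$ and $G[V(C)\cup\{x,y\}]$ contains a cycle $C'$ and an edge $xy_i$ (with $y_i\in V(C)$) such that $xy_i$ is vertex-disjoint from $C'$, $|C'|=|C|$ and $|S_{C'}|=|S_C|$. (4) If $xy\in E(G)$, then $e(\{x,y\},C)\le \frac12|C|$.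
   Context: All graphs are finite and simple. For a subgraph $H$ and vertex $v$, $d_H(v)=|N_G(v)\cap V(H)|$ and $N_H(v)=N_G(v)\cap V(H)$. For $U\subseteq V(G)$, $U_H=U\cap V(H)$ (e.g. $S_C=S\cap V(C)$, $X_C=X\cap V(C)$). For vertex sets/subgraphs $A,B$, $e(A,B)$ is the number of edges of $G$ with one end in $A$ and the other in $B$. $|C|$ denotes the number of vertices of $C$. -}

module Defs where

open import Data.Nat using (ℕ; zero; suc; _+_; _*_; _≤_; _<_)
open import Data.Nat.DivMod using (_%_; m%n<n)

open import Data.Fin using (Fin; zero; suc; toℕ; fromℕ<)
open import Data.Bool using (Bool; true; false; if_then_else_; not)
open import Data.Product using (Σ; ∃; _×_; _,_)
open import Data.Sum using (_⊎_)
open import Relation.Binary.PropositionalEquality using (_≡_; _≢_)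
open import Relation.Nullary using (¬_)
open import Function using (_∘_)
open import Function.Definitions using (Injective)

record Graph (n : ℕ) : Set where
  field
    adj    : Fin n → Fin n → Bool
    sym    : ∀ u v → adj u v ≡ adj v u
    irrefl : ∀ v → adj v v ≡ false
open Graph public

count : ∀ {k} → (Fin k → Bool) → ℕ
count {zero}  f = 0
count {suc k} f = (if f zero then 1 else 0) + count (f ∘ suc)

sucMod : ∀ {k} → Fin k → Fin k
sucMod {suc k} i = fromℕ< (m%n<n (suc (toℕ i)) (suc k))

-- (X,Y) bipartition given by side : true = X, false = Y.
-- Balanced bipartite graph with this bipartition.
IsBalancedBipartite : ∀ {n} → Graph n → (Fin n → Bool) → Set
IsBalancedBipartite G side =
  (∀ u v → adj G u v ≡ true → side u ≢ side v)
  × count side ≡ count (not ∘ side)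

IsCycle : ∀ {n} → Graph n → (k : ℕ) → (Fin k → Fin n) → Set
IsCycle G k c = (3 ≤ k) × Injective _≡_ _≡_ c × (∀ i → adj G (c i) (c (sucMod i)) ≡ true)

countOn : ∀ {n k} → (Fin n → Bool) → (Fin k → Fin n) → ℕ
countOn P c = count (P ∘ c)

-- The labelled cycle C = x_1 y_1 x_2 y_2 ... x_m y_m x_1, given by xs, ys : Fin m → Fin n,
-- with x_i ∈ X, y_i ∈ Y, and |C| = 2m ≥ 6.
IsXYCycle : ∀ {n} → Graph n → (Fin n → Bool) → (m : ℕ) → (Fin m → Fin n) → (Fin m → Fin n) → Set
IsXYCycle G side m xs ys =
  (3 ≤ m)
  × Injective _≡_ _≡_ xs × Injective _≡_ _≡_ ys × (∀ i j → xs i ≢ ys j)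
  × (∀ i → side (xs i) ≡ true) × (∀ i → side (ys i) ≡ false)
  × (∀ i → adj G (xs i) (ys i) ≡ true)
  × (∀ i → adj G (ys i) (xs (sucMod i)) ≡ true)

InC : ∀ {n m} → (Fin m → Fin n) → (Fin m → Fin n) → Fin n → Set
InC xs ys v = (∃ λ i → xs i ≡ v) ⊎ (∃ λ i → ys i ≡ v)

countC : ∀ {n m} → (Fin n → Bool) → (Fin m → Fin n) → (Fin m → Fin n) → ℕ
countC P xs ys = count (P ∘ xs) + count (P ∘ ys)

dC : ∀ {n m} → Graph n → (Fin m → Fin n) → (Fin m → Fin n) → Fin n → ℕ
dC G xs ys v = countC (adj G v) xs ys

-- e({x,y},C) for x ≠ y both outside C
e2C : ∀ {n m} → Graph n → (Fin m → Fin n) → (Fin m → Fin n) → Fin n → Fin n → ℕ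
e2C G xs ys x y = dC G xs ys x + dC G xs ys y

MinimalSystem : ∀ {n m} → Graph n → (Fin n → Bool) → (Fin m → Fin n) → (Fin m → Fin n) → Set
MinimalSystem {n} {m} G S xs ys =
  (2 ≤ countC S xs ys)
  × (∀ k (c : Fin k → Fin n) → IsCycle G k c → 2 ≤ countOn S c → ¬ (k < m + m))

-- C is unrolled into the 2m-periodic walk x_0 y_0 x_1 y_1 … on ℕ, so that arcs of C become
-- intervals. A vertex outside C with two neighbours on C, or an outside edge joining two vertices
-- of C, closes with the arc between them a cycle shorter than C as soon as the other arc is long
-- enough; by minimality that cycle holds at most one S-vertex. Each part is then a pigeonhole
-- argument on the positions of the neighbours of x and y and of the (at least two) S-vertices:
-- three neighbours of x, five of y, or all m of y would trap two S-vertices in such a cycle, and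
-- so would too many neighbours of an adjacent pair x, y. For (3) these bounds force x to have two
-- neighbours on C and y to miss exactly one x_j, which lies in S; then some neighbour y_i of x has
-- x_i and x_{i+1} adjacent to y, and replacing y_i by y gives C'.
module Submission where

open import Data.Bool using (Bool; true; false; not; if_then_else_)
open import Data.Bool.Properties using (not-injective; ¬-not)
open import Data.Empty using (⊥; ⊥-elim)
open import Data.Fin using (Fin; zero; suc; toℕ; fromℕ<)
open import Data.Fin.Properties using (toℕ-injective; toℕ-fromℕ<; toℕ<n)
open import Data.Nat hiding (parity)
open import Data.Nat.DivMod using (_%_; m%n<n; m<n⇒m%n≡m; [m+n]%n≡m%n; m%n%n≡m%n; %-distribˡ-+; n%n≡0)
open import Data.Nat.Properties
open import Data.Nat.Tactic.RingSolver using (solve-∀)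
open import Algebra.Properties.CommutativeSemigroup +-commutativeSemigroup
  using (x∙yz≈y∙xz) renaming (interchange to +-interchange)
open import Data.Product using (Σ; _×_; _,_; proj₁; proj₂)
open import Data.Sum using (_⊎_; inj₁; inj₂)
open import Function using (_∘_)
open import Function.Bundles using (_⇔_; mk⇔)
open import Function.Definitions using (Injective)
open import Relation.Binary.Definitions using (tri<; tri≈; tri>)
open import Relation.Binary.PropositionalEquality
open import Relation.Nullary using (¬_; Dec; yes; no)

open import Defs renaming (sym to adj-sym)

true≢false : true ≢ false
true≢false ()

bit : Bool → ℕ
bit b = if b then 1 else 0

countBelow : (ℕ → Bool) → ℕ → ℕ
countBelow f zero    = 0
countBelow f (suc k) = bit (f 0) + countBelow (f ∘ suc) k

countBelow-cong : ∀ k {f g : ℕ → Bool} → (∀ i → i < k → f i ≡ g i) → countBelow f k ≡ countBelow g k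
countBelow-cong zero    f≗g = refl
countBelow-cong (suc k) f≗g =
  cong₂ _+_ (cong bit (f≗g 0 z<s)) (countBelow-cong k (λ i i<k → f≗g (suc i) (s<s i<k)))

countBelow-+ : ∀ a b (f : ℕ → Bool) → countBelow f (a + b) ≡ countBelow f a + countBelow (λ i → f (a + i)) b
countBelow-+ zero    b f = refl
countBelow-+ (suc a) b f = trans (cong (bit (f 0) +_) (countBelow-+ a b (f ∘ suc))) (sym (+-assoc (bit (f 0)) _ _))

countBelow-suc : ∀ k (f : ℕ → Bool) → countBelow f (suc k) ≡ countBelow f k + bit (f k)
countBelow-suc zero    f = +-identityʳ _
countBelow-suc (suc k) f = trans (cong (bit (f 0) +_) (countBelow-suc k (f ∘ suc))) (sym (+-assoc (bit (f 0)) _ _))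

count≡countBelow : ∀ {k} (g : Fin k → Bool) (f : ℕ → Bool) → (∀ i → g i ≡ f (toℕ i)) → count g ≡ countBelow f k
count≡countBelow {zero}  g f g≗f = refl
count≡countBelow {suc k} g f g≗f = cong₂ _+_ (cong bit (g≗f zero)) (count≡countBelow (g ∘ suc) (f ∘ suc) (g≗f ∘ suc))

countBelow≤ : ∀ k f → countBelow f k ≤ k
countBelow≤ zero    f = z≤n
countBelow≤ (suc k) f with f 0
... | true  = s≤s (countBelow≤ k (f ∘ suc))
... | false = m≤n⇒m≤1+n (countBelow≤ k (f ∘ suc))

countBelow-none : ∀ k f → (∀ i → i < k → f i ≡ false) → countBelow f k ≡ 0
countBelow-none zero    f none = refl
countBelow-none (suc k) f none rewrite none 0 z<s = countBelow-none k (f ∘ suc) (λ i i<k → none (suc i) (s<s i<k))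

countBelow-full : ∀ k f → k ≤ countBelow f k → ∀ i → i < k → f i ≡ true
countBelow-full (suc k) f full i i<k with f 0 in f0
countBelow-full (suc k) f full       zero    i<k       | true  = f0
countBelow-full (suc k) f (s≤s full) (suc i) (s≤s i<k) | true  = countBelow-full k (f ∘ suc) full i i<k
countBelow-full (suc k) f full       i       i<k       | false = ⊥-elim (<-irrefl refl (≤-trans full (countBelow≤ k (f ∘ suc))))

countBelow-not : ∀ k f → countBelow f k + countBelow (not ∘ f) k ≡ k
countBelow-not zero    f = refl
countBelow-not (suc k) f with f 0
... | true  = cong suc (countBelow-not k (f ∘ suc))
... | false = trans (+-suc (countBelow (f ∘ suc) k) _) (cong suc (countBelow-not k (f ∘ suc)))

countBelow-≥1 : ∀ k f i → i < k → f i ≡ true → 1 ≤ countBelow f k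
countBelow-≥1 (suc k) f zero    i<k       fi rewrite fi = s≤s z≤n
countBelow-≥1 (suc k) f (suc i) (s≤s i<k) fi = ≤-trans (countBelow-≥1 k (f ∘ suc) i i<k fi) (m≤n+m _ (bit (f 0)))

countBelow-≥2 : ∀ k f i j → i < j → j < k → f i ≡ true → f j ≡ true → 2 ≤ countBelow f k
countBelow-≥2 k f i j i<j j<k fi fj = subst (2 ≤_) (sym split)
  (+-mono-≤ (countBelow-≥1 j f i i<j fi) (countBelow-≥1 (k ∸ j) (λ r → f (j + r)) 0 (m<n⇒0<n∸m j<k) (trans (cong f (+-identityʳ j)) fj)))
  where
  split : countBelow f k ≡ countBelow f j + countBelow (λ r → f (j + r)) (k ∸ j)
  split = trans (cong (countBelow f) (sym (m+[n∸m]≡n (<⇒≤ j<k)))) (countBelow-+ j (k ∸ j) f)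

countBelow-last : ∀ k f r → suc r ≤ countBelow f k → Σ ℕ λ j → j < k × f j ≡ true × r ≤ countBelow f j
countBelow-last (suc k) f r r<cnt with f k in fk | subst (suc r ≤_) (countBelow-suc k f) r<cnt
... | true  | r<cnt′ = k , ≤-refl , fk , ≤-pred (subst (suc r ≤_) (+-comm (countBelow f k) 1) r<cnt′)
... | false | r<cnt′ with countBelow-last k f r (subst (suc r ≤_) (+-identityʳ _) r<cnt′)
...   | j , j<k , fj , r≤ = j , m≤n⇒m≤1+n j<k , fj , r≤

countBelow≤1-unique : ∀ k f → countBelow f k ≤ 1 → ∀ i j → i < k → j < k → f i ≡ true → f j ≡ true → i ≡ j
countBelow≤1-unique k f ≤1 i j i<k j<k fi fj with <-cmp i j
... | tri< i<j _ _ = ⊥-elim (<⇒≱ (countBelow-≥2 k f i j i<j j<k fi fj) ≤1)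
... | tri≈ _ i≡j _ = i≡j
... | tri> _ _ j<i = ⊥-elim (<⇒≱ (countBelow-≥2 k f j i j<i i<k fj fi) ≤1)

two-witnesses : ∀ k f → 2 ≤ countBelow f k → Σ ℕ λ a → Σ ℕ λ b → a < b × b < k × f a ≡ true × f b ≡ true
two-witnesses k f two with countBelow-last k f 1 two
... | b , b<k , fb , one with countBelow-last b f 0 one
...   | a , a<b , fa , _ = a , b , a<b , b<k , fa , fb

three-witnesses : ∀ k f → 3 ≤ countBelow f k →
  Σ ℕ λ a → Σ ℕ λ b → Σ ℕ λ c → a < b × b < c × c < k × f a ≡ true × f b ≡ true × f c ≡ true
three-witnesses k f three with countBelow-last k f 2 three
... | c , c<k , fc , two with two-witnesses c f two
...   | a , b , a<b , b<c , fa , fb = a , b , c , a<b , b<c , c<k , fa , fb , fc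

five-witnesses : ∀ k f → 5 ≤ countBelow f k →
  Σ ℕ λ a → Σ ℕ λ b → Σ ℕ λ c → Σ ℕ λ d → Σ ℕ λ e →
  a < b × b < c × c < d × d < e × e < k × f a ≡ true × f b ≡ true × f c ≡ true × f d ≡ true × f e ≡ true
five-witnesses k f five with countBelow-last k f 4 five
... | e , e<k , fe , four with countBelow-last e f 3 four
...   | d , d<e , fd , three with three-witnesses d f three
...     | a , b , c , a<b , b<c , c<d , fa , fb , fc = a , b , c , d , e , a<b , b<c , c<d , d<e , e<k , fa , fb , fc , fd , fe

countBelow-rotate₁ : ∀ m f → (∀ i → f (m + i) ≡ f i) → countBelow (f ∘ suc) m ≡ countBelow f m
countBelow-rotate₁ zero    f periodic = refl
countBelow-rotate₁ (suc m) f periodic = begin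
  countBelow (f ∘ suc) (suc m)             ≡⟨ countBelow-suc m (f ∘ suc) ⟩
  countBelow (f ∘ suc) m + bit (f (suc m)) ≡⟨ cong (λ b → countBelow (f ∘ suc) m + bit b) wrap ⟩
  countBelow (f ∘ suc) m + bit (f 0)       ≡⟨ +-comm _ (bit (f 0)) ⟩
  countBelow f (suc m)                     ∎
  where
  open ≡-Reasoning
  wrap : f (suc m) ≡ f 0
  wrap = trans (cong f (sym (+-identityʳ (suc m)))) (periodic 0)

countBelow-rotate : ∀ m f o → (∀ i → f (m + i) ≡ f i) → countBelow (λ i → f (o + i)) m ≡ countBelow f m
countBelow-rotate m f zero    periodic = refl
countBelow-rotate m f (suc o) periodic =
  trans (countBelow-cong m (λ i _ → cong f (sym (+-suc o i))))
  (trans (countBelow-rotate₁ m (λ i → f (o + i)) (λ i → trans (cong f (x∙yz≈y∙xz o m i)) (periodic (o + i))))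
         (countBelow-rotate m f o periodic))

%-window-injective : ∀ m .{{_ : NonZero m}} i j → i % m ≡ j % m → i ≤ j → j < i + m → i ≡ j
%-window-injective m i j i≡j i≤j j<i+m = trans (sym (+-identityʳ i)) (trans (cong (i +_) (sym d≡0)) (m+[n∸m]≡n i≤j))
  where
  d r : ℕ
  d = j ∸ i
  r = i % m
  i+d≡j : i + d ≡ j
  i+d≡j = m+[n∸m]≡n i≤j
  d<m : d < m
  d<m = +-cancelˡ-< i d m (subst (_< i + m) (sym i+d≡j) j<i+m)
  r+d%m≡r : (r + d) % m ≡ r
  r+d%m≡r = begin
    (r + d) % m          ≡⟨ cong (λ e → (r + e) % m) (sym (m<n⇒m%n≡m d<m)) ⟩
    (r + d % m) % m      ≡⟨ sym (%-distribˡ-+ i d m) ⟩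
    (i + d) % m          ≡⟨ cong (_% m) i+d≡j ⟩
    j % m                ≡⟨ sym i≡j ⟩
    r                    ∎
    where open ≡-Reasoning
  d≡0 : d ≡ 0
  d≡0 with r + d <? m
  ... | yes r+d<m = +-cancelˡ-≡ r d 0 (trans (trans (sym (m<n⇒m%n≡m r+d<m)) r+d%m≡r) (sym (+-identityʳ r)))
  ... | no r+d≮m = ⊥-elim (<-irrefl d≡m d<m)
    where
    wrapped : r + d ∸ m + m ≡ r + d
    wrapped = m∸n+n≡m (≮⇒≥ r+d≮m)
    wrapped<m : r + d ∸ m < m
    wrapped<m = +-cancelʳ-< m _ m (subst (_< m + m) (sym wrapped) (+-mono-< (m%n<n i m) d<m))
    wrapped≡r : r + d ∸ m ≡ r
    wrapped≡r = trans (sym (m<n⇒m%n≡m wrapped<m))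
                (trans (sym ([m+n]%n≡m%n (r + d ∸ m) m)) (trans (cong (_% m) wrapped) r+d%m≡r))
    d≡m : d ≡ m
    d≡m = +-cancelˡ-≡ r d m (trans (sym wrapped) (cong (_+ m) wrapped≡r))

double-cancel-≤ : ∀ i j → i + i ≤ j + j → i ≤ j
double-cancel-≤ i j i+i≤j+j with i ≤? j
... | yes i≤j = i≤j
... | no  i≰j = ⊥-elim (<⇒≱ (+-mono-< (≰⇒> i≰j) (≰⇒> i≰j)) i+i≤j+j)

double-cancel-< : ∀ i j → i + i < j + j → i < j
double-cancel-< i j i+i<j+j with i <? j
... | yes i<j = i<j
... | no  i≮j = ⊥-elim (<⇒≱ i+i<j+j (+-mono-≤ (≮⇒≥ i≮j) (≮⇒≥ i≮j)))

m<n<o⇒m+2≤o : ∀ {m n o} → m < n → n < o → m + 2 ≤ o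
m<n<o⇒m+2≤o {m} {n} {o} m<n n<o = subst (_≤ o) (+-comm 2 m) (≤-trans (s≤s m<n) n<o)

m<n⇒m+2≤o+n : ∀ {m n o} → m < n → 0 < o → m + 2 ≤ o + n
m<n⇒m+2≤o+n {m} {n} m<n 0<o = ≤-trans (subst (_≤ suc n) (+-comm 2 m) (s≤s m<n)) (+-monoˡ-≤ n 0<o)

double-≤ : ∀ a b k l → b + k ≤ a + l → (b + b) + (k + k) ≤ (a + a) + (l + l)
double-≤ a b k l h = subst₂ _≤_ (+-interchange b k b k) (+-interchange a l a l) (+-mono-≤ h h)

isCycle-fromℕ : ∀ {n} (G : Graph n) (k : ℕ) (f : ℕ → Fin n) → 3 ≤ k →
  (∀ r r' → r < k → r' < k → f r ≡ f r' → r ≡ r') →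
  (∀ r → suc r < k → adj G (f r) (f (suc r)) ≡ true) →
  adj G (f (pred k)) (f 0) ≡ true →
  IsCycle G k (λ i → f (toℕ i))
isCycle-fromℕ G k@(suc _) f 3≤k f-inj step close =
  3≤k , (λ {i} {j} e → toℕ-injective (f-inj (toℕ i) (toℕ j) (toℕ<n i) (toℕ<n j) e)) , edges
  where
  edges : ∀ i → adj G (f (toℕ i)) (f (toℕ (sucMod i))) ≡ true
  edges i with suc (toℕ i) <? k
  ... | yes i+1<k = subst (λ r → adj G (f (toℕ i)) (f r) ≡ true)
                      (sym (trans (toℕ-fromℕ< _) (m<n⇒m%n≡m i+1<k))) (step (toℕ i) i+1<k)
  ... | no  i+1≮k = subst₂ (λ a b → adj G (f a) (f b) ≡ true) (sym (cong pred i+1≡k))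
                      (sym (trans (toℕ-fromℕ< _) (trans (cong (_% k) i+1≡k) (n%n≡0 k)))) close
    where
    i+1≡k : suc (toℕ i) ≡ k
    i+1≡k = ≤-antisym (toℕ<n i) (≮⇒≥ i+1≮k)

countOn-fromℕ : ∀ {n} (S : Fin n → Bool) (k : ℕ) (f : ℕ → Fin n) →
  countOn S (λ (i : Fin k) → f (toℕ i)) ≡ countBelow (S ∘ f) k
countOn-fromℕ S k f = count≡countBelow {k} _ (S ∘ f) (λ i → refl)

module MinimalCycle {n} (G : Graph n) (side : Fin n → Bool)
  (bipartite : ∀ u v → adj G u v ≡ true → side u ≢ side v)
  (S : Fin n → Bool) (S⊆X : ∀ v → S v ≡ true → side v ≡ true)
  (M : ℕ) (3≤m : 3 ≤ suc M) (xs ys : Fin (suc M) → Fin n)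
  (xs-inj : Injective _≡_ _≡_ xs) (ys-inj : Injective _≡_ _≡_ ys) (xs≢ys : ∀ i j → xs i ≢ ys j)
  (xs∈X : ∀ i → side (xs i) ≡ true) (ys∈Y : ∀ i → side (ys i) ≡ false)
  (xy-edge : ∀ i → adj G (xs i) (ys i) ≡ true) (yx-edge : ∀ i → adj G (ys i) (xs (sucMod i)) ≡ true)
  (two-S : 2 ≤ countC S xs ys)
  (minimal : ∀ k (c : Fin k → Fin n) → IsCycle G k c → 2 ≤ countOn S c → ¬ (k < suc M + suc M))
  where

  m : ℕ
  m = suc M

  idx : ℕ → Fin m
  idx i = fromℕ< (m%n<n i m)

  toℕ-idx : ∀ i → toℕ (idx i) ≡ i % m
  toℕ-idx i = toℕ-fromℕ< _

  idx-cong-% : ∀ i j → i % m ≡ j % m → idx i ≡ idx j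
  idx-cong-% i j e = toℕ-injective (trans (toℕ-idx i) (trans e (sym (toℕ-idx j))))

  idx-toℕ : ∀ k → idx (toℕ k) ≡ k
  idx-toℕ k = toℕ-injective (trans (toℕ-idx (toℕ k)) (m<n⇒m%n≡m (toℕ<n k)))

  idx-+m : ∀ i → idx (i + m) ≡ idx i
  idx-+m i = idx-cong-% (i + m) i ([m+n]%n≡m%n i m)

  sucMod-idx : ∀ i → sucMod (idx i) ≡ idx (suc i)
  sucMod-idx i = idx-cong-% (suc (toℕ (idx i))) (suc i) (begin
    suc (toℕ (idx i)) % m        ≡⟨ cong (λ r → suc r % m) (toℕ-idx i) ⟩
    (1 + i % m) % m              ≡⟨ %-distribˡ-+ 1 (i % m) m ⟩
    (1 % m + i % m % m) % m      ≡⟨ cong (λ r → (1 % m + r) % m) (m%n%n≡m%n i m) ⟩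
    (1 % m + i % m) % m          ≡⟨ sym (%-distribˡ-+ 1 i m) ⟩
    suc i % m                    ∎)
    where open ≡-Reasoning

  xAt yAt : ℕ → Fin n
  xAt i = xs (idx i)
  yAt i = ys (idx i)

  xAt-+m : ∀ i → xAt (i + m) ≡ xAt i
  xAt-+m i = cong xs (idx-+m i)

  xAt-m+ : ∀ i → xAt (m + i) ≡ xAt i
  xAt-m+ i = trans (cong xAt (+-comm m i)) (xAt-+m i)

  yAt-+m : ∀ i → yAt (i + m) ≡ yAt i
  yAt-+m i = cong ys (idx-+m i)

  walkFrom : ℕ → ℕ → Fin n
  walkFrom i zero          = xAt i
  walkFrom i (suc zero)    = yAt i
  walkFrom i (suc (suc p)) = walkFrom (suc i) p

  walk : ℕ → Fin n
  walk = walkFrom 0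

  walkFrom-even : ∀ i j → walkFrom i (j + j) ≡ xAt (i + j)
  walkFrom-even i zero    = cong xAt (sym (+-identityʳ i))
  walkFrom-even i (suc j) rewrite +-suc j j = trans (walkFrom-even (suc i) j) (cong xAt (sym (+-suc i j)))

  walkFrom-odd : ∀ i j → walkFrom i (suc (j + j)) ≡ yAt (i + j)
  walkFrom-odd i zero    = cong yAt (sym (+-identityʳ i))
  walkFrom-odd i (suc j) rewrite +-suc j j = trans (walkFrom-odd (suc i) j) (cong yAt (sym (+-suc i j)))

  walk-even : ∀ j → walk (j + j) ≡ xAt j
  walk-even = walkFrom-even 0

  walk-odd : ∀ j → walk (suc (j + j)) ≡ yAt j
  walk-odd = walkFrom-odd 0

  data Parity : ℕ → Set where
    even : ∀ i → Parity (i + i)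
    odd  : ∀ i → Parity (suc (i + i))

  parity : ∀ p → Parity p
  parity zero          = even 0
  parity (suc zero)    = odd 0
  parity (suc (suc p)) with parity p
  ... | even i = subst Parity (cong suc (+-suc i i)) (even (suc i))
  ... | odd  i = subst Parity (cong (2 +_) (+-suc i i)) (odd (suc i))

  walk-adjacent : ∀ p → adj G (walk p) (walk (suc p)) ≡ true
  walk-adjacent p with parity p
  ... | even i = subst₂ (λ a b → adj G a b ≡ true) (sym (walk-even i)) (sym (walk-odd i)) (xy-edge (idx i))
  ... | odd  i = subst₂ (λ a b → adj G a b ≡ true) (sym (walk-odd i)) (sym (walkFrom-even 1 i))
                   (subst (λ k → adj G (yAt i) (xs k) ≡ true) (sucMod-idx i) (yx-edge (idx i)))

  walk-periodic : ∀ p → walk (p + (m + m)) ≡ walk p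
  walk-periodic p with parity p
  ... | even i = trans (cong walk (+-interchange i i m m)) (trans (walk-even (i + m)) (trans (xAt-+m i) (sym (walk-even i))))
  ... | odd  i = trans (cong (walk ∘ suc) (+-interchange i i m m)) (trans (walk-odd (i + m)) (trans (yAt-+m i) (sym (walk-odd i))))

  idx-injective-window : ∀ i j → idx i ≡ idx j → i ≤ j → j < i + m → i ≡ j
  idx-injective-window i j e = %-window-injective m i j (trans (sym (toℕ-idx i)) (trans (cong toℕ e) (toℕ-idx j)))

  walk-injective : ∀ a b → a ≤ b → b < a + (m + m) → walk a ≡ walk b → a ≡ b
  walk-injective a b a≤b b<a+2m e with parity a | parity b
  ... | even i | even j = cong (λ k → k + k)
    (idx-injective-window i j (xs-inj (trans (sym (walk-even i)) (trans e (walk-even j))))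
      (double-cancel-≤ i j a≤b) (double-cancel-< j (i + m) (subst (j + j <_) (+-interchange i i m m) b<a+2m)))
  ... | even i | odd  j = ⊥-elim (xs≢ys _ _ (trans (sym (walk-even i)) (trans e (walk-odd j))))
  ... | odd  i | even j = ⊥-elim (xs≢ys _ _ (trans (sym (walk-even j)) (trans (sym e) (walk-odd i))))
  ... | odd  i | odd  j = cong (λ k → suc (k + k))
    (idx-injective-window i j (ys-inj (trans (sym (walk-odd i)) (trans e (walk-odd j))))
      (double-cancel-≤ i j (≤-pred a≤b)) (double-cancel-< j (i + m) (subst (j + j <_) (+-interchange i i m m) (≤-pred b<a+2m))))

  walk-injective-< : ∀ a b → a < m + m → b < m + m → walk a ≡ walk b → a ≡ b
  walk-injective-< a b a<2m b<2m e with ≤-total a b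
  ... | inj₁ a≤b = walk-injective a b a≤b (≤-trans b<2m (m≤n+m _ a)) e
  ... | inj₂ b≤a = sym (walk-injective b a b≤a (≤-trans a<2m (m≤n+m _ b)) (sym e))

  walk-inC : ∀ p → InC xs ys (walk p)
  walk-inC p with parity p
  ... | even i = inj₁ (idx i , sym (walk-even i))
  ... | odd  i = inj₂ (idx i , sym (walk-odd i))

  walk-avoids : ∀ v → ¬ InC xs ys v → ∀ p → walk p ≢ v
  walk-avoids v v∉C p e = v∉C (subst (InC xs ys) e (walk-inC p))

  Y⇒¬S : ∀ v → side v ≡ false → S v ≡ false
  Y⇒¬S v v∈Y with S v in Sv
  ... | true  = ⊥-elim (true≢false (trans (sym (S⊆X v Sv)) v∈Y))
  ... | false = refl

  yAt∉S : ∀ i → S (yAt i) ≡ false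
  yAt∉S i = Y⇒¬S _ (ys∈Y (idx i))

  count-xs : ∀ (g : Fin n → Bool) → count (g ∘ xs) ≡ countBelow (g ∘ xAt) m
  count-xs g = count≡countBelow {m} (g ∘ xs) (g ∘ xAt) (λ k → cong (g ∘ xs) (sym (idx-toℕ k)))

  count-ys : ∀ (g : Fin n → Bool) → count (g ∘ ys) ≡ countBelow (g ∘ yAt) m
  count-ys g = count≡countBelow {m} (g ∘ ys) (g ∘ yAt) (λ k → cong (g ∘ ys) (sym (idx-toℕ k)))

  countC-S : countC S xs ys ≡ countBelow (S ∘ xAt) m
  countC-S = trans (cong₂ _+_ (count-xs S) (trans (count-ys S) (countBelow-none m _ (λ i _ → yAt∉S i)))) (+-identityʳ _)

  same-side-non-adjacent : ∀ u v → side u ≡ side v → adj G u v ≡ false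
  same-side-non-adjacent u v same with adj G u v in uv
  ... | true  = ⊥-elim (bipartite u v uv same)
  ... | false = refl

  d-ys d-xs : Fin n → ℕ
  d-ys v = countBelow (λ i → adj G v (yAt i)) m
  d-xs v = countBelow (λ i → adj G v (xAt i)) m

  dC-X : ∀ x → side x ≡ true → dC G xs ys x ≡ d-ys x
  dC-X x x∈X = cong₂ _+_
    (trans (count-xs (adj G x)) (countBelow-none m _ (λ i _ → same-side-non-adjacent x _ (trans x∈X (sym (xs∈X (idx i)))))))
    (count-ys (adj G x))

  dC-Y : ∀ y → side y ≡ false → dC G xs ys y ≡ d-xs y
  dC-Y y y∈Y = trans (cong₂ _+_ (count-xs (adj G y))
    (trans (count-ys (adj G y)) (countBelow-none m _ (λ i _ → same-side-non-adjacent y _ (trans y∈Y (sym (ys∈Y (idx i))))))))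
    (+-identityʳ _)

  two : 2 ≤ countBelow (S ∘ xAt) m
  two = subst (2 ≤_) countC-S two-S

  short-cycle-S≤1 : ∀ k (f : ℕ → Fin n) → 3 ≤ k → k < m + m →
    (∀ r r' → r < k → r' < k → f r ≡ f r' → r ≡ r') →
    (∀ r → suc r < k → adj G (f r) (f (suc r)) ≡ true) →
    adj G (f (pred k)) (f 0) ≡ true →
    countBelow (S ∘ f) k ≤ 1
  short-cycle-S≤1 k f 3≤k k<2m f-inj step close = ≤-pred (≰⇒> λ two →
    minimal k _ (isCycle-fromℕ G k f 3≤k f-inj step close) (subst (2 ≤_) (sym (countOn-fromℕ S k f)) two) k<2m)

  module Detour (p t len : ℕ) (w : ℕ → Fin n) where

    detour : ℕ → Fin n
    detour r with r ≤? t
    ... | yes _ = walk (p + r)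
    ... | no  _ = w (r ∸ suc t)

    detour-arc : ∀ r → r ≤ t → detour r ≡ walk (p + r)
    detour-arc r r≤t with r ≤? t
    ... | yes _   = refl
    ... | no  r≰t = ⊥-elim (r≰t r≤t)

    detour-path : ∀ i → detour (suc t + i) ≡ w i
    detour-path i with suc t + i ≤? t
    ... | yes t+i<t = ⊥-elim (<⇒≱ (s≤s (m≤m+n t i)) t+i<t)
    ... | no  _     = cong w (m+n∸m≡n (suc t) i)

    arc-or-path : ∀ r → r < suc t + len → r ≤ t ⊎ Σ ℕ λ i → i < len × r ≡ suc t + i
    arc-or-path r r< with r ≤? t
    ... | yes r≤t = inj₁ r≤t
    ... | no  r≰t = inj₂ (r ∸ suc t , +-cancelˡ-< (suc t) _ _ (subst (_< suc t + len) (sym t+i≡r) r<) , sym t+i≡r)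
      where
      t+i≡r : suc t + (r ∸ suc t) ≡ r
      t+i≡r = m+[n∸m]≡n (≰⇒> r≰t)

    detour-S≤1 : 1 ≤ len → 3 ≤ suc t + len → suc t + len < m + m →
      (∀ i → i < len → ∀ r → walk r ≢ w i) →
      (∀ i j → i < len → j < len → w i ≡ w j → i ≡ j) →
      (∀ i → suc i < len → adj G (w i) (w (suc i)) ≡ true) →
      adj G (walk (p + t)) (w 0) ≡ true →
      adj G (w (pred len)) (walk p) ≡ true →
      countBelow (λ r → S (walk (p + r))) (suc t) + countBelow (S ∘ w) len ≤ 1
    detour-S≤1 1≤len 3≤k k<2m w∉C w-inj w-edge arc→w w→arc =
      subst (_≤ 1) S-split (short-cycle-S≤1 k detour 3≤k k<2m detour-inj step close)
      where
      k : ℕ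
      k = suc t + len

      S-split : countBelow (S ∘ detour) k ≡ countBelow (λ r → S (walk (p + r))) (suc t) + countBelow (S ∘ w) len
      S-split = trans (countBelow-+ (suc t) len (S ∘ detour))
        (cong₂ _+_ (countBelow-cong (suc t) (λ i i≤t → cong S (detour-arc i (≤-pred i≤t))))
                   (countBelow-cong len (λ i _ → cong S (detour-path i))))

      arc-inj : ∀ r r' → r ≤ r' → r' ≤ t → walk (p + r) ≡ walk (p + r') → r ≡ r'
      arc-inj r r' r≤r' r'≤t e = +-cancelˡ-≡ p r r'
        (walk-injective (p + r) (p + r') (+-monoʳ-≤ p r≤r') (subst (p + r' <_) (sym (+-assoc p r (m + m))) p+r'<) e)
        where
        p+r'< : p + r' < p + (r + (m + m))
        p+r'< = +-monoʳ-< p (<-≤-trans (s≤s r'≤t) (≤-trans (m≤m+n (suc t) len) (<⇒≤ (≤-trans k<2m (m≤n+m (m + m) r)))))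

      detour-inj : ∀ r r' → r < k → r' < k → detour r ≡ detour r' → r ≡ r'
      detour-inj r r' r< r'< e with arc-or-path r r< | arc-or-path r' r'<
      ... | inj₁ r≤t | inj₁ r'≤t with ≤-total r r'
      ...   | inj₁ r≤r' = arc-inj r r' r≤r' r'≤t (trans (sym (detour-arc r r≤t)) (trans e (detour-arc r' r'≤t)))
      ...   | inj₂ r'≤r = sym (arc-inj r' r r'≤r r≤t (trans (sym (detour-arc r' r'≤t)) (trans (sym e) (detour-arc r r≤t))))
      detour-inj r r' r< r'< e | inj₁ r≤t | inj₂ (i , i< , refl) =
        ⊥-elim (w∉C i i< (p + r) (trans (sym (detour-arc r r≤t)) (trans e (detour-path i))))
      detour-inj r r' r< r'< e | inj₂ (i , i< , refl) | inj₁ r'≤t =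
        ⊥-elim (w∉C i i< (p + r') (trans (sym (detour-arc r' r'≤t)) (trans (sym e) (detour-path i))))
      detour-inj r r' r< r'< e | inj₂ (i , i< , refl) | inj₂ (j , j< , refl) =
        cong (suc t +_) (w-inj i j i< j< (trans (sym (detour-path i)) (trans e (detour-path j))))

      arc-step : ∀ r → r ≤ t → Dec (suc r ≤ t) → adj G (detour r) (detour (suc r)) ≡ true
      arc-step r r≤t (yes r<t) = subst₂ (λ u v → adj G u v ≡ true) (sym (detour-arc r r≤t))
        (sym (trans (detour-arc (suc r) r<t) (cong walk (+-suc p r)))) (walk-adjacent (p + r))
      arc-step r r≤t (no  r≮t) = subst₂ (λ u v → adj G u v ≡ true)
        (sym (trans (detour-arc r r≤t) (cong (λ z → walk (p + z)) r≡t)))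
        (sym (trans (cong detour (trans (cong suc r≡t) (sym (+-identityʳ (suc t))))) (detour-path 0))) arc→w
        where
        r≡t : r ≡ t
        r≡t = ≤-antisym r≤t (≤-pred (≰⇒> r≮t))

      step : ∀ r → suc r < k → adj G (detour r) (detour (suc r)) ≡ true
      step r r+1<k with arc-or-path r (<-trans (n<1+n r) r+1<k)
      ... | inj₁ r≤t = arc-step r r≤t (suc r ≤? t)
      step r r+1<k | inj₂ (i , i< , refl) =
        subst₂ (λ u v → adj G u v ≡ true) (sym (detour-path i)) (sym (trans (cong detour (sym (+-suc (suc t) i))) (detour-path (suc i))))
          (w-edge i (+-cancelˡ-< (suc t) _ _ (subst (_< k) (sym (+-suc (suc t) i)) r+1<k)))

      close : adj G (detour (pred k)) (detour 0) ≡ true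
      close = subst₂ (λ u v → adj G u v ≡ true) (sym (trans (cong detour last) (detour-path (pred len))))
        (sym (trans (detour-arc 0 z≤n) (cong walk (+-identityʳ p)))) w→arc
        where
        last : pred k ≡ suc t + pred len
        last = sym (trans (sym (+-suc t (pred len))) (cong (t +_) (suc-pred len ⦃ >-nonZero 1≤len ⦄)))

  arc-S≥1 : ∀ p q s → p ≤ s → s ≤ q → S (walk s) ≡ true → 1 ≤ countBelow (λ r → S (walk (p + r))) (suc (q ∸ p))
  arc-S≥1 p q s p≤s s≤q Ss = countBelow-≥1 _ (λ r → S (walk (p + r))) (s ∸ p) (s≤s (∸-monoˡ-≤ p s≤q))
    (trans (cong (S ∘ walk) (m+[n∸m]≡n p≤s)) Ss)

  arc-S≥2 : ∀ p q s s' → p ≤ s → s < s' → s' ≤ q → S (walk s) ≡ true → S (walk s') ≡ true →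
    2 ≤ countBelow (λ r → S (walk (p + r))) (suc (q ∸ p))
  arc-S≥2 p q s s' p≤s s<s' s'≤q Ss Ss' = countBelow-≥2 _ (λ r → S (walk (p + r))) (s ∸ p) (s' ∸ p)
    (∸-monoˡ-< s<s' p≤s) (s≤s (∸-monoˡ-≤ p s'≤q))
    (trans (cong (S ∘ walk) (m+[n∸m]≡n p≤s)) Ss) (trans (cong (S ∘ walk) (m+[n∸m]≡n (≤-trans p≤s (<⇒≤ s<s')))) Ss')

  chord-S≤1 : ∀ v → ¬ InC xs ys v → ∀ p q → p < q → q + 3 ≤ p + (m + m) →
    adj G v (walk p) ≡ true → adj G v (walk q) ≡ true →
    bit (S v) + countBelow (λ r → S (walk (p + r))) (suc (q ∸ p)) ≤ 1
  chord-S≤1 v v∉C p q p<q short v~p v~q =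
    subst (_≤ 1) (trans (cong (countBelow (λ r → S (walk (p + r))) (suc t) +_) (+-identityʳ _)) (+-comm _ (bit (S v))))
      (Detour.detour-S≤1 p t 1 (λ _ → v) ≤-refl (+-monoˡ-≤ 1 (s≤s (m<n⇒0<n∸m p<q))) k<2m
        (λ _ _ r → walk-avoids v v∉C r) single (λ { i (s≤s ()) })
        (subst (λ z → adj G (walk z) v ≡ true) (sym p+t≡q) (trans (adj-sym G _ _) v~q)) v~p)
    where
    t : ℕ
    t = q ∸ p
    p+t≡q : p + t ≡ q
    p+t≡q = m+[n∸m]≡n (<⇒≤ p<q)
    k<2m : suc t + 1 < m + m
    k<2m = +-cancelˡ-≤ p _ _ (subst (_≤ p + (m + m)) (trans (cong (_+ 3) (sym p+t≡q)) (reassoc p t)) short)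
      where
      reassoc : ∀ p t → p + t + 3 ≡ p + suc (suc t + 1)
      reassoc = solve-∀
    single : ∀ i j → i < 1 → j < 1 → v ≡ v → i ≡ j
    single zero zero _ _ _ = refl
    single (suc i) _ (s≤s ()) _ _
    single zero (suc j) _ (s≤s ()) _

  chord-S-excludes-S : ∀ v → ¬ InC xs ys v → S v ≡ true → ∀ p q → p < q → q + 3 ≤ p + (m + m) →
    adj G v (walk p) ≡ true → adj G v (walk q) ≡ true →
    ∀ s → p ≤ s → s ≤ q → S (walk s) ≡ true → ⊥
  chord-S-excludes-S v v∉C Sv p q p<q short v~p v~q s p≤s s≤q Ss =
    <-irrefl refl (≤-trans (+-mono-≤ (≤-reflexive (sym (cong bit Sv))) (arc-S≥1 p q s p≤s s≤q Ss))
                           (chord-S≤1 v v∉C p q p<q short v~p v~q))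

  chord-excludes-two-S : ∀ v → ¬ InC xs ys v → ∀ p q → p < q → q + 3 ≤ p + (m + m) →
    adj G v (walk p) ≡ true → adj G v (walk q) ≡ true →
    ∀ s s' → p ≤ s → s < s' → s' ≤ q → S (walk s) ≡ true → S (walk s') ≡ true → ⊥
  chord-excludes-two-S v v∉C p q p<q short v~p v~q s s' p≤s s<s' s'≤q Ss Ss' =
    <⇒≱ (≤-trans (arc-S≥2 p q s s' p≤s s<s' s'≤q Ss Ss') (m≤n+m _ (bit (S v)))) (chord-S≤1 v v∉C p q p<q short v~p v~q)

  pair : Fin n → Fin n → ℕ → Fin n
  pair u w zero    = u
  pair u w (suc _) = w

  edge-chord-S≤1 : ∀ u w → ¬ InC xs ys u → ¬ InC xs ys w → u ≢ w → adj G u w ≡ true →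
    ∀ p q → p ≤ q → q + 4 ≤ p + (m + m) → adj G u (walk q) ≡ true → adj G w (walk p) ≡ true →
    countBelow (λ r → S (walk (p + r))) (suc (q ∸ p)) + (bit (S u) + (bit (S w) + 0)) ≤ 1
  edge-chord-S≤1 u w u∉C w∉C u≢w u~w p q p≤q short u~q w~p =
    Detour.detour-S≤1 p t 2 (pair u w) (s≤s z≤n) (subst (3 ≤_) (+-comm 2 (suc t)) (s≤s (s≤s (s≤s z≤n)))) k<2m
      pair∉C pair-inj pair-edge (subst (λ z → adj G (walk z) u ≡ true) (sym p+t≡q) (trans (adj-sym G _ _) u~q)) w~p
    where
    t : ℕ
    t = q ∸ p
    p+t≡q : p + t ≡ q
    p+t≡q = m+[n∸m]≡n p≤q
    k<2m : suc t + 2 < m + m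
    k<2m = +-cancelˡ-≤ p _ _ (subst (_≤ p + (m + m)) (trans (cong (_+ 4) (sym p+t≡q)) (reassoc p t)) short)
      where
      reassoc : ∀ p t → p + t + 4 ≡ p + suc (suc t + 2)
      reassoc = solve-∀
    pair∉C : ∀ i → i < 2 → ∀ r → walk r ≢ pair u w i
    pair∉C zero    _ r = walk-avoids u u∉C r
    pair∉C (suc i) _ r = walk-avoids w w∉C r
    pair-inj : ∀ i j → i < 2 → j < 2 → pair u w i ≡ pair u w j → i ≡ j
    pair-inj zero          zero          _ _ _ = refl
    pair-inj zero          (suc zero)    _ _ e = ⊥-elim (u≢w e)
    pair-inj (suc zero)    zero          _ _ e = ⊥-elim (u≢w (sym e))
    pair-inj (suc zero)    (suc zero)    _ _ _ = refl
    pair-inj (suc (suc i)) _             (s≤s (s≤s ())) _ _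
    pair-inj _             (suc (suc j)) _ (s≤s (s≤s ())) _
    pair-edge : ∀ i → suc i < 2 → adj G (pair u w i) (pair u w (suc i)) ≡ true
    pair-edge zero    _ = u~w
    pair-edge (suc i) (s≤s (s≤s ()))

  edge-chord-excludes-S : ∀ u w → ¬ InC xs ys u → ¬ InC xs ys w → u ≢ w → adj G u w ≡ true →
    ∀ p q → p ≤ q → q + 4 ≤ p + (m + m) → adj G u (walk q) ≡ true → adj G w (walk p) ≡ true →
    S u ≡ true ⊎ S w ≡ true → ∀ s → p ≤ s → s ≤ q → S (walk s) ≡ true → ⊥
  edge-chord-excludes-S u w u∉C w∉C u≢w u~w p q p≤q short u~q w~p Su⊎Sw s p≤s s≤q Ss =
    <-irrefl refl (≤-trans (+-mono-≤ (arc-S≥1 p q s p≤s s≤q Ss) (ends-S≥1 Su⊎Sw))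
                           (edge-chord-S≤1 u w u∉C w∉C u≢w u~w p q p≤q short u~q w~p))
    where
    ends-S≥1 : S u ≡ true ⊎ S w ≡ true → 1 ≤ bit (S u) + (bit (S w) + 0)
    ends-S≥1 (inj₁ Su) rewrite Su = s≤s z≤n
    ends-S≥1 (inj₂ Sw) rewrite Sw = m≤n+m 1 (bit (S u))

  S-even : ∀ i → S (xAt i) ≡ true → S (walk (i + i)) ≡ true
  S-even i = subst (λ z → S z ≡ true) (sym (walk-even i))

  adj-even : ∀ v i → adj G v (xAt i) ≡ true → adj G v (walk (i + i)) ≡ true
  adj-even v i = subst (λ z → adj G v z ≡ true) (sym (walk-even i))

  adj-odd : ∀ v i → adj G v (yAt i) ≡ true → adj G v (walk (suc (i + i))) ≡ true
  adj-odd v i = subst (λ z → adj G v z ≡ true) (sym (walk-odd i))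

  S-xAt-+m : ∀ i → S (xAt i) ≡ true → S (xAt (i + m)) ≡ true
  S-xAt-+m i = subst (λ z → S z ≡ true) (sym (xAt-+m i))

  adj-xAt-+m : ∀ v i → adj G v (xAt i) ≡ true → adj G v (xAt (i + m)) ≡ true
  adj-xAt-+m v i = subst (λ z → adj G v z ≡ true) (sym (xAt-+m i))

  adj-yAt-+m : ∀ v i → adj G v (yAt i) ≡ true → adj G v (yAt (i + m)) ≡ true
  adj-yAt-+m v i = subst (λ z → adj G v z ≡ true) (sym (yAt-+m i))

  NoS : ℕ → ℕ → Set
  NoS lo hi = ∀ s → lo ≤ s → s ≤ hi → S (xAt s) ≡ true → ⊥

  AtMostOneS : ℕ → ℕ → Set
  AtMostOneS lo hi = ∀ s s' → lo ≤ s → s < s' → s' ≤ hi → S (xAt s) ≡ true → S (xAt s') ≡ true → ⊥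

  wrapped-short : ∀ b a → b + 2 ≤ a → b + m + 2 ≤ a + m
  wrapped-short b a b+2≤a = subst (_≤ a + m) (reassoc b m) (+-monoˡ-≤ m b+2≤a)
    where
    reassoc : ∀ b k → b + 2 + k ≡ b + k + 2
    reassoc = solve-∀

  S-chord-yy-excludes-S : ∀ v → ¬ InC xs ys v → S v ≡ true → ∀ a b → a < b → b + 2 ≤ a + m →
    adj G v (yAt a) ≡ true → adj G v (yAt b) ≡ true → NoS (suc a) b
  S-chord-yy-excludes-S v v∉C Sv a b a<b short v~a v~b s a<s s≤b Ss =
    chord-S-excludes-S v v∉C Sv (suc (a + a)) (suc (b + b)) (s≤s (+-mono-< a<b a<b)) short′
      (adj-odd v a v~a) (adj-odd v b v~b) (s + s) (+-mono-≤ a<s (<⇒≤ a<s)) (≤-trans (+-mono-≤ s≤b s≤b) (n≤1+n _)) (S-even s Ss)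
    where
    reassoc : ∀ b → suc (b + b) + 3 ≡ b + b + (2 + 2)
    reassoc = solve-∀
    short′ : suc (b + b) + 3 ≤ suc (a + a) + (m + m)
    short′ = ≤-trans (≤-reflexive (reassoc b)) (≤-trans (double-≤ a b 2 m short) (n≤1+n _))

  chord-xx-excludes-two-S : ∀ v → ¬ InC xs ys v → ∀ a b → a < b → b + 2 ≤ a + m →
    adj G v (xAt a) ≡ true → adj G v (xAt b) ≡ true → AtMostOneS a b
  chord-xx-excludes-two-S v v∉C a b a<b short v~a v~b s s' a≤s s<s' s'≤b Ss Ss' =
    chord-excludes-two-S v v∉C (a + a) (b + b) (+-mono-< a<b a<b) short′ (adj-even v a v~a) (adj-even v b v~b)
      (s + s) (s' + s') (+-mono-≤ a≤s a≤s) (+-mono-< s<s' s<s') (+-mono-≤ s'≤b s'≤b) (S-even s Ss) (S-even s' Ss')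
    where
    short′ : b + b + 3 ≤ a + a + (m + m)
    short′ = ≤-trans (+-monoʳ-≤ (b + b) (n≤1+n 3)) (double-≤ a b 2 m short)

  -- The same chord read the other way round the cycle, through the index b + m.
  wrapped-chord-xx-excludes-two-S : ∀ v → ¬ InC xs ys v → ∀ a b → b + 2 ≤ a → a < m →
    adj G v (xAt a) ≡ true → adj G v (xAt b) ≡ true → AtMostOneS a (b + m)
  wrapped-chord-xx-excludes-two-S v v∉C a b b+2≤a a<m v~a v~b =
    chord-xx-excludes-two-S v v∉C a (b + m) (≤-trans a<m (m≤n+m m b)) (wrapped-short b a b+2≤a) v~a (adj-xAt-+m v b v~b)

  wrapped-S-chord-yy-excludes-S : ∀ v → ¬ InC xs ys v → S v ≡ true → ∀ a b → b + 2 ≤ a → a < m →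
    adj G v (yAt a) ≡ true → adj G v (yAt b) ≡ true → NoS (suc a) (b + m)
  wrapped-S-chord-yy-excludes-S v v∉C Sv a b b+2≤a a<m v~a v~b =
    S-chord-yy-excludes-S v v∉C Sv a (b + m) (≤-trans a<m (m≤n+m m b)) (wrapped-short b a b+2≤a) v~a (adj-yAt-+m v b v~b)

  edge-chord-yx-excludes-S : ∀ u w → ¬ InC xs ys u → ¬ InC xs ys w → u ≢ w → adj G u w ≡ true → S u ≡ true →
    ∀ a b → a ≤ b → b + 3 ≤ a + m → adj G u (yAt b) ≡ true → adj G w (xAt a) ≡ true → NoS a b
  edge-chord-yx-excludes-S u w u∉C w∉C u≢w u~w Su a b a≤b short u~b w~a s a≤s s≤b Ss =
    edge-chord-excludes-S u w u∉C w∉C u≢w u~w (a + a) (suc (b + b)) (≤-trans (+-mono-≤ a≤b a≤b) (n≤1+n _)) short′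
      (adj-odd u b u~b) (adj-even w a w~a) (inj₁ Su) (s + s) (+-mono-≤ a≤s a≤s) (≤-trans (+-mono-≤ s≤b s≤b) (n≤1+n _)) (S-even s Ss)
    where
    reassoc : ∀ b → suc (b + b) + 4 ≡ b + b + 5
    reassoc = solve-∀
    short′ : suc (b + b) + 4 ≤ a + a + (m + m)
    short′ = ≤-trans (≤-reflexive (reassoc b)) (≤-trans (+-monoʳ-≤ (b + b) (n≤1+n 5)) (double-≤ a b 3 m short))

  edge-chord-xy-excludes-S : ∀ u w → ¬ InC xs ys u → ¬ InC xs ys w → u ≢ w → adj G u w ≡ true → S u ≡ true →
    ∀ a b → b < a → a + 2 ≤ b + m → adj G u (yAt b) ≡ true → adj G w (xAt a) ≡ true → NoS (suc b) a
  edge-chord-xy-excludes-S u w u∉C w∉C u≢w u~w Su a b b<a short u~b w~a s b<s s≤a Ss =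
    edge-chord-excludes-S w u w∉C u∉C (u≢w ∘ sym) (trans (adj-sym G w u) u~w) (suc (b + b)) (a + a) (+-mono-≤ b<a (<⇒≤ b<a)) short′
      (adj-even w a w~a) (adj-odd u b u~b) (inj₂ Su) (s + s) (+-mono-≤ b<s (<⇒≤ b<s)) (+-mono-≤ s≤a s≤a) (S-even s Ss)
    where
    short′ : a + a + 4 ≤ suc (b + b) + (m + m)
    short′ = ≤-trans (double-≤ b a 2 m short) (n≤1+n _)

  -- Three neighbours of x split the cycle into three short arcs, one of which contains an S-vertex.
  x-degree≤2 : ∀ x → ¬ InC xs ys x → S x ≡ true → d-ys x ≤ 2
  x-degree≤2 x x∉C Sx = ≤-pred (≰⇒> no-three-neighbours)
    where
    no-three-neighbours : ¬ (3 ≤ d-ys x)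
    no-three-neighbours three with three-witnesses m _ three | two-witnesses m (S ∘ xAt) two
    ... | a , b , c , a<b , b<c , c<m , x~a , x~b , x~c | s , _ , s<s' , s'<m , Ss , _ with s ≤? a | s ≤? b | s ≤? c
    ... | yes s≤a | _ | _ =
      wrapped-S-chord-yy-excludes-S x x∉C Sx c a (m<n<o⇒m+2≤o a<b b<c) c<m x~c x~a
        (s + m) (≤-trans c<m (m≤n+m m s)) (+-monoˡ-≤ m s≤a) (S-xAt-+m s Ss)
    ... | no s≰a | yes s≤b | _ =
      S-chord-yy-excludes-S x x∉C Sx a b a<b (≤-trans (m<n<o⇒m+2≤o b<c c<m) (m≤n+m m a)) x~a x~b s (≰⇒> s≰a) s≤b Ss
    ... | no _ | no s≰b | yes s≤c =
      S-chord-yy-excludes-S x x∉C Sx b c b<c (m<n⇒m+2≤o+n c<m (≤-trans (s≤s z≤n) a<b)) x~b x~c s (≰⇒> s≰b) s≤c Ss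
    ... | no _ | no _ | no s≰c =
      wrapped-S-chord-yy-excludes-S x x∉C Sx c a (m<n<o⇒m+2≤o a<b b<c) c<m x~c x~a
        s (≰⇒> s≰c) (≤-trans (<⇒≤ (<-trans s<s' s'<m)) (m≤n+m m a)) Ss

  -- With five neighbours x_a, …, x_e of y, each of the arcs [a,d], [b,e], [c,a+m], [d,b+m], [e,c+m]
  -- holds at most one S-vertex, and every two positions of the cycle lie together in one of them.
  y-degree≤4 : ∀ y → ¬ InC xs ys y → d-xs y ≤ 4
  y-degree≤4 y y∉C = ≤-pred (≰⇒> no-five-neighbours)
    where
    no-five-neighbours : ¬ (5 ≤ d-xs y)
    no-five-neighbours five with five-witnesses m _ five | two-witnesses m (S ∘ xAt) two
    ... | a , b , c , d , e , a<b , b<c , c<d , d<e , e<m , y~a , y~b , y~c , y~d , y~e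
        | s₁ , s₂ , s₁<s₂ , s₂<m , S₁ , S₂ = split (s₁ ≤? b) (s₁ <? d) (s₂ ≤? b) (s₂ <? d)
      where
      c<m : c < m
      c<m = <-trans c<d (<-trans d<e e<m)
      d<m : d < m
      d<m = <-trans d<e e<m
      0<b : 0 < b
      0<b = ≤-trans (s≤s z≤n) a<b
      arc-db : AtMostOneS d (b + m)
      arc-db = wrapped-chord-xx-excludes-two-S y y∉C d b (m<n<o⇒m+2≤o b<c c<d) d<m y~d y~b
      arc-ec : AtMostOneS e (c + m)
      arc-ec = wrapped-chord-xx-excludes-two-S y y∉C e c (m<n<o⇒m+2≤o c<d d<e) e<m y~e y~c
      arc-ca : AtMostOneS c (a + m)
      arc-ca = wrapped-chord-xx-excludes-two-S y y∉C c a (m<n<o⇒m+2≤o a<b b<c) c<m y~c y~a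
      arc-be : AtMostOneS b e
      arc-be = chord-xx-excludes-two-S y y∉C b e (<-trans b<c (<-trans c<d d<e)) (m<n⇒m+2≤o+n e<m 0<b) y~b y~e
      arc-ad : AtMostOneS a d
      arc-ad = chord-xx-excludes-two-S y y∉C a d (<-trans a<b (<-trans b<c c<d))
        (≤-trans (m<n<o⇒m+2≤o d<e e<m) (m≤n+m m a)) y~a y~d
      s₁+m<s₂+m : s₁ + m < s₂ + m
      s₁+m<s₂+m = +-monoˡ-< m s₁<s₂
      S₁+m : S (xAt (s₁ + m)) ≡ true
      S₁+m = S-xAt-+m s₁ S₁
      S₂+m : S (xAt (s₂ + m)) ≡ true
      S₂+m = S-xAt-+m s₂ S₂
      s₁-in-bd : b ≤ s₁ → Dec (s₂ ≤ e) → Dec (s₁ ≤ c) → ⊥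
      s₁-in-bd b≤s₁ (yes s₂≤e) _          = arc-be s₁ s₂ b≤s₁ s₁<s₂ s₂≤e S₁ S₂
      s₁-in-bd b≤s₁ (no s₂≰e)  (yes s₁≤c) =
        arc-ec s₂ (s₁ + m) (<⇒≤ (≰⇒> s₂≰e)) (≤-trans s₂<m (m≤n+m m s₁)) (+-monoˡ-≤ m s₁≤c) S₂ S₁+m
      s₁-in-bd b≤s₁ (no s₂≰e)  (no s₁≰c)  =
        arc-ca s₁ s₂ (<⇒≤ (≰⇒> s₁≰c)) s₁<s₂ (≤-trans (<⇒≤ s₂<m) (m≤n+m m a)) S₁ S₂
      s₂-in-bd : s₂ < d → Dec (a ≤ s₁) → Dec (s₂ ≤ c) → ⊥
      s₂-in-bd s₂<d (yes a≤s₁) _          = arc-ad s₁ s₂ a≤s₁ s₁<s₂ (<⇒≤ s₂<d) S₁ S₂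
      s₂-in-bd s₂<d (no a≰s₁)  (yes s₂≤c) =
        arc-ec (s₁ + m) (s₂ + m) (≤-trans (<⇒≤ e<m) (m≤n+m m s₁)) s₁+m<s₂+m (+-monoˡ-≤ m s₂≤c) S₁+m S₂+m
      s₂-in-bd s₂<d (no a≰s₁)  (no s₂≰c)  =
        arc-ca s₂ (s₁ + m) (<⇒≤ (≰⇒> s₂≰c)) (≤-trans s₂<m (m≤n+m m s₁)) (+-monoˡ-≤ m (<⇒≤ (≰⇒> a≰s₁))) S₂ S₁+m
      split : Dec (s₁ ≤ b) → Dec (s₁ < d) → Dec (s₂ ≤ b) → Dec (s₂ < d) → ⊥
      split (yes s₁≤b) _ (yes s₂≤b) _ =
        arc-db (s₁ + m) (s₂ + m) (≤-trans (<⇒≤ d<m) (m≤n+m m s₁)) s₁+m<s₂+m (+-monoˡ-≤ m s₂≤b) S₁+m S₂+m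
      split (yes s₁≤b) _ (no _) (no s₂≮d) =
        arc-db s₂ (s₁ + m) (≮⇒≥ s₂≮d) (≤-trans s₂<m (m≤n+m m s₁)) (+-monoˡ-≤ m s₁≤b) S₂ S₁+m
      split (no _) (no s₁≮d) _ _ = arc-db s₁ s₂ (≮⇒≥ s₁≮d) s₁<s₂ (≤-trans (<⇒≤ s₂<m) (m≤n+m m b)) S₁ S₂
      split (no s₁≰b) (yes _) _ _ = s₁-in-bd (<⇒≤ (≰⇒> s₁≰b)) (s₂ ≤? e) (s₁ ≤? c)
      split (yes _) _ (no s₂≰b) (yes s₂<d) = s₂-in-bd s₂<d (a ≤? s₁) (s₂ ≤? c)

  common-neighbour-of-S-pair : ∀ y → ¬ InC xs ys y → ∀ s₁ s₂ → s₁ < s₂ → s₂ < m →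
    adj G y (xAt s₁) ≡ true → adj G y (xAt s₂) ≡ true → S (xAt s₁) ≡ true → S (xAt s₂) ≡ true → ⊥
  common-neighbour-of-S-pair y y∉C s₁ s₂ s₁<s₂ s₂<m y~s₁ y~s₂ S₁ S₂ with s₂ + 2 ≤? s₁ + m
  ... | yes short = chord-xx-excludes-two-S y y∉C s₁ s₂ s₁<s₂ short y~s₁ y~s₂ s₁ s₂ ≤-refl s₁<s₂ ≤-refl S₁ S₂
  ... | no  long  = wrapped-chord-xx-excludes-two-S y y∉C s₂ s₁ s₁+2≤s₂ s₂<m y~s₂ y~s₁
                      s₂ (s₁ + m) ≤-refl (≤-trans s₂<m (m≤n+m m s₁)) ≤-refl S₂ (S-xAt-+m s₁ S₁)
    where
    s₁+2≤s₂ : s₁ + 2 ≤ s₂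
    s₁+2≤s₂ = +-cancelʳ-≤ 1 (s₁ + 2) s₂ (begin
      s₁ + 2 + 1  ≡⟨ +-assoc s₁ 2 1 ⟩
      s₁ + 3      ≤⟨ +-monoʳ-≤ s₁ 3≤m ⟩
      s₁ + m      ≤⟨ ≤-pred (subst (suc (s₁ + m) ≤_) (+-suc s₂ 1) (≰⇒> long)) ⟩
      s₂ + 1      ∎)
      where open ≤-Reasoning

  y-degree<m : ∀ y → ¬ InC xs ys y → d-xs y + 1 ≤ m
  y-degree<m y y∉C with d-xs y + 1 ≤? m
  ... | yes d<m = d<m
  ... | no  d≮m with two-witnesses m (S ∘ xAt) two
  ...   | s₁ , s₂ , s₁<s₂ , s₂<m , S₁ , S₂ =
    ⊥-elim (common-neighbour-of-S-pair y y∉C s₁ s₂ s₁<s₂ s₂<m (y~all s₁ (<-trans s₁<s₂ s₂<m)) (y~all s₂ s₂<m) S₁ S₂)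
    where
    y~all : ∀ i → i < m → adj G y (xAt i) ≡ true
    y~all = countBelow-full m _ (+-cancelʳ-≤ 1 m _ (subst (_≤ d-xs y + 1) (+-comm 1 m) (≰⇒> d≮m)))

  ≢-mod-window : ∀ j i → j < m → j < i → i < j + m → i % m ≢ j
  ≢-mod-window j i j<m j<i i<j+m i≡j = <-irrefl (%-window-injective m j i (trans (m<n⇒m%n≡m j<m) (sym i≡j)) (<⇒≤ j<i) i<j+m) j<i

  module AlmostFull (y : Fin n) (y∉C : ¬ InC xs ys y) (jF : Fin m)
    (y≁j : adj G y (xs jF) ≡ false) (only-j : ∀ i → adj G y (xs i) ≡ false → i ≡ jF) where

    j : ℕ
    j = toℕ jF

    j<m : j < m
    j<m = toℕ<n jF

    y~ : ∀ i → i % m ≢ j → adj G y (xAt i) ≡ true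
    y~ i i≢j with adj G y (xAt i) in y~i
    ... | true  = refl
    ... | false = ⊥-elim (i≢j (trans (sym (toℕ-idx i)) (cong toℕ (only-j (idx i) y~i))))

    y~< : ∀ i → i < m → i ≢ j → adj G y (xAt i) ≡ true
    y~< i i<m i≢j = y~ i (λ e → i≢j (trans (sym (m<n⇒m%n≡m i<m)) e))

    no-two-S-besides-j : ∀ s t → s < t → t < m → s ≢ j → t ≢ j → S (xAt s) ≡ true → S (xAt t) ≡ true → ⊥
    no-two-S-besides-j s t s<t t<m s≢j t≢j =
      common-neighbour-of-S-pair y y∉C s t s<t t<m (y~< s (<-trans s<t t<m) s≢j) (y~< t t<m t≢j)

    unique-S-besides-j : ∀ s t → s < m → t < m → s ≢ j → t ≢ j → S (xAt s) ≡ true → S (xAt t) ≡ true → s ≡ t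
    unique-S-besides-j s t s<m t<m s≢j t≢j Ss St with <-cmp s t
    ... | tri< s<t _ _ = ⊥-elim (no-two-S-besides-j s t s<t t<m s≢j t≢j Ss St)
    ... | tri≈ _ s≡t _ = s≡t
    ... | tri> _ _ t<s = ⊥-elim (no-two-S-besides-j t s t<s s<m t≢j s≢j St Ss)

    S-j : S (xAt j) ≡ true
    S-j with two-witnesses m (S ∘ xAt) two
    ... | s₁ , s₂ , s₁<s₂ , s₂<m , S₁ , S₂ with s₁ ≟ j | s₂ ≟ j
    ...   | yes s₁≡j | _        = subst (λ z → S (xAt z) ≡ true) s₁≡j S₁
    ...   | no  _    | yes s₂≡j = subst (λ z → S (xAt z) ≡ true) s₂≡j S₂
    ...   | no  s₁≢j | no  s₂≢j = ⊥-elim (no-two-S-besides-j s₁ s₂ s₁<s₂ s₂<m s₁≢j s₂≢j S₁ S₂)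

    S-count≡2 : countBelow (S ∘ xAt) m ≡ 2
    S-count≡2 = ≤-antisym (≤-pred (≰⇒> no-three)) two
      where
      no-three : ¬ (3 ≤ countBelow (S ∘ xAt) m)
      no-three three with three-witnesses m (S ∘ xAt) three
      ... | s₁ , s₂ , s₃ , s₁<s₂ , s₂<s₃ , s₃<m , S₁ , S₂ , S₃ with s₁ ≟ j | s₂ ≟ j
      ...   | yes s₁≡j | _ = no-two-S-besides-j s₂ s₃ s₂<s₃ s₃<m
                (λ e → <-irrefl (trans s₁≡j (sym e)) s₁<s₂) (λ e → <-irrefl (trans s₁≡j (sym e)) (<-trans s₁<s₂ s₂<s₃)) S₂ S₃
      ...   | no s₁≢j | yes s₂≡j = no-two-S-besides-j s₁ s₃ (<-trans s₁<s₂ s₂<s₃) s₃<m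
                s₁≢j (λ e → <-irrefl (trans s₂≡j (sym e)) s₂<s₃) S₁ S₃
      ...   | no s₁≢j | no s₂≢j = no-two-S-besides-j s₁ s₂ s₁<s₂ (<-trans s₂<s₃ s₃<m) s₁≢j s₂≢j S₁ S₂

    other-S : Σ ℕ λ a → a < m × a ≢ j × S (xAt a) ≡ true
    other-S with two-witnesses m (S ∘ xAt) two
    ... | s₁ , s₂ , s₁<s₂ , s₂<m , S₁ , S₂ with s₁ ≟ j
    ...   | yes s₁≡j = s₂ , s₂<m , (λ e → <-irrefl (trans s₁≡j (sym e)) s₁<s₂) , S₂
    ...   | no  s₁≢j = s₁ , <-trans s₁<s₂ s₂<m , s₁≢j , S₁

    a₀ : ℕ
    a₀ = proj₁ other-S

    a₀<m : a₀ < m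
    a₀<m = proj₁ (proj₂ other-S)

    a₀≢j : a₀ ≢ j
    a₀≢j = proj₁ (proj₂ (proj₂ other-S))

    S-a₀ : S (xAt a₀) ≡ true
    S-a₀ = proj₂ (proj₂ (proj₂ other-S))

    lift-after-j : ∀ a₀ → a₀ < m → a₀ ≢ j → Σ ℕ λ a → j < a × a < j + m × a % m ≡ a₀
    lift-after-j a₀ a₀<m a₀≢j with <-cmp j a₀
    ... | tri< j<a₀ _ _ = a₀ , j<a₀ , ≤-trans a₀<m (m≤n+m m j) , m<n⇒m%n≡m a₀<m
    ... | tri≈ _ j≡a₀ _ = ⊥-elim (a₀≢j (sym j≡a₀))
    ... | tri> _ _ a₀<j = a₀ + m , ≤-trans j<m (m≤n+m m a₀) , +-monoˡ-< m a₀<j , trans ([m+n]%n≡m%n a₀ m) (m<n⇒m%n≡m a₀<m)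

    after-j : Σ ℕ λ a → j < a × a < j + m × a % m ≡ a₀
    after-j = lift-after-j a₀ a₀<m a₀≢j

    a : ℕ
    a = proj₁ after-j

    j<a : j < a
    j<a = proj₁ (proj₂ after-j)

    a<j+m : a < j + m
    a<j+m = proj₁ (proj₂ (proj₂ after-j))

    a%m≡a₀ : a % m ≡ a₀
    a%m≡a₀ = proj₂ (proj₂ (proj₂ after-j))

    xAt-a : xAt a ≡ xAt a₀
    xAt-a = cong xs (idx-cong-% a a₀ (trans a%m≡a₀ (sym (m<n⇒m%n≡m a₀<m))))

    S-a : S (xAt a) ≡ true
    S-a = trans (cong S xAt-a) S-a₀

    y~a : adj G y (xAt a) ≡ true
    y~a = y~ a (λ e → a₀≢j (trans (sym a%m≡a₀) e))

    -- y sees x_{j-1} and x_{j+1}, so a chord of y would hold both S-vertices x_j and x_a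
    -- unless a is within distance 2 of j on either side.
    a-not-far-before-j : ¬ (a + 3 ≤ j + m)
    a-not-far-before-j short =
      chord-xx-excludes-two-S y y∉C (j + M) (a + m) (+-mono-< j<a (n<1+n M)) short′ y~j+M (adj-xAt-+m y a y~a)
        (j + m) (a + m) (+-monoʳ-≤ j (n≤1+n M)) (+-monoˡ-< m j<a) ≤-refl (S-xAt-+m j S-j) (S-xAt-+m a S-a)
      where
      reassoc : ∀ a k → a + 2 + k ≡ a + k + 2
      reassoc = solve-∀
      short′ : a + m + 2 ≤ j + M + m
      short′ = subst (_≤ j + M + m) (reassoc a m) (+-monoˡ-≤ m (≤-pred (subst₂ _≤_ (+-suc a 2) (+-suc j M) short)))
      y~j+M : adj G y (xAt (j + M)) ≡ true
      y~j+M = y~ (j + M) (≢-mod-window j (j + M) j<m (m<m+n j (≤-trans (s≤s z≤n) (≤-pred 3≤m))) (+-monoʳ-< j (n<1+n M)))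

    a-not-far-after-j : ¬ (j + 3 ≤ a)
    a-not-far-after-j far =
      chord-xx-excludes-two-S y y∉C a (j + 1 + m) (≤-trans a<j+m (+-monoˡ-≤ m (m≤m+n j 1))) short y~a y~j+1+m
        a (j + m) ≤-refl a<j+m (+-monoˡ-≤ m (m≤m+n j 1)) S-a (S-xAt-+m j S-j)
      where
      reassoc : ∀ j k → j + 1 + k + 2 ≡ j + 3 + k
      reassoc = solve-∀
      short : j + 1 + m + 2 ≤ a + m
      short = subst (_≤ a + m) (sym (reassoc j m)) (+-monoˡ-≤ m far)
      y~j+1+m : adj G y (xAt (j + 1 + m)) ≡ true
      y~j+1+m = adj-xAt-+m y (j + 1)
        (y~ (j + 1) (≢-mod-window j (j + 1) j<m (m<m+n j (s≤s z≤n)) (+-monoʳ-< j (≤-trans (s≤s (s≤s z≤n)) 3≤m))))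

    j+m≤a+2 : j + m ≤ a + 2
    j+m≤a+2 = ≤-pred (subst (j + m <_) (+-suc a 2) (≰⇒> a-not-far-before-j))

    a≤j+2 : a ≤ j + 2
    a≤j+2 = ≤-pred (subst (a <_) (+-suc j 2) (≰⇒> a-not-far-after-j))

    m≤4 : m ≤ 4
    m≤4 = +-cancelˡ-≤ j m 4 (subst (j + m ≤_) (reassoc j) (≤-trans j+m≤a+2 (+-monoˡ-≤ 2 a≤j+2)))
      where
      reassoc : ∀ j → j + 2 + 2 ≡ j + 4
      reassoc = solve-∀

    m≡4⇒a≡j+2 : m ≡ 4 → a ≡ j + 2
    m≡4⇒a≡j+2 m≡4 = ≤-antisym a≤j+2 (+-cancelʳ-≤ 2 (j + 2) a (subst (_≤ a + 2) (trans (cong (j +_) m≡4) (reassoc j)) j+m≤a+2))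
      where
      reassoc : ∀ j → j + 4 ≡ j + 2 + 2
      reassoc = solve-∀

    m+m≡8⇒m≡4 : m + m ≡ 8 → m ≡ 4
    m+m≡8⇒m≡4 m+m≡8 = ≤-antisym m≤4 (double-cancel-≤ 4 m (≤-reflexive (sym m+m≡8)))

    S-on-C : m ≡ 4 → ∀ v → ((S v ≡ true) × InC xs ys v) ⇔ (v ≡ xs jF ⊎ v ≡ xs (sucMod (sucMod jF)))
    S-on-C m≡4 v = mk⇔ to from
      where
      xs-j : xAt j ≡ xs jF
      xs-j = cong xs (idx-toℕ jF)
      xs-j+2 : xs (sucMod (sucMod jF)) ≡ xAt a₀
      xs-j+2 = begin
        xs (sucMod (idx (suc j)))  ≡⟨ cong xs (sucMod-idx (suc j)) ⟩
        xAt (2 + j)                ≡⟨ cong xAt (trans (+-comm 2 j) (sym (m≡4⇒a≡j+2 m≡4))) ⟩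
        xAt a                      ≡⟨ xAt-a ⟩
        xAt a₀                     ∎
        where open ≡-Reasoning
      to : (S v ≡ true) × InC xs ys v → v ≡ xs jF ⊎ v ≡ xs (sucMod (sucMod jF))
      to (Sv , inj₂ (k , ys-k≡v)) = ⊥-elim (true≢false (trans (sym Sv) (trans (cong S (sym ys-k≡v)) (Y⇒¬S _ (ys∈Y k)))))
      to (Sv , inj₁ (k , xs-k≡v)) with toℕ k ≟ j
      ... | yes k≡j = inj₁ (trans (sym xs-k≡v) (cong xs (toℕ-injective k≡j)))
      ... | no  k≢j = inj₂ (begin
        v                          ≡⟨ sym xs-k≡v ⟩
        xs k                       ≡⟨ cong xs (sym (idx-toℕ k)) ⟩
        xAt (toℕ k)                ≡⟨ cong xAt k≡a₀ ⟩
        xAt a₀                     ≡⟨ sym xs-j+2 ⟩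
        xs (sucMod (sucMod jF))    ∎)
        where
        open ≡-Reasoning
        k≡a₀ : toℕ k ≡ a₀
        k≡a₀ = unique-S-besides-j (toℕ k) a₀ (toℕ<n k) a₀<m k≢j a₀≢j
          (trans (cong S (trans (cong xs (idx-toℕ k)) xs-k≡v)) Sv) S-a₀
      from : v ≡ xs jF ⊎ v ≡ xs (sucMod (sucMod jF)) → (S v ≡ true) × InC xs ys v
      from (inj₁ v≡j)   = trans (cong S (trans v≡j (sym xs-j))) S-j , inj₁ (jF , sym v≡j)
      from (inj₂ v≡j+2) = trans (cong S (trans v≡j+2 xs-j+2)) S-a₀ , inj₁ (sucMod (sucMod jF) , sym v≡j+2)

  almost-full-y : ∀ y → ¬ InC xs ys y → (j : Fin m) → adj G y (xs j) ≡ false → (∀ i → adj G y (xs i) ≡ false → i ≡ j) →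
    (S (xs j) ≡ true) × (countC S xs ys ≡ 2) × (m + m ≤ 8)
    × (m + m ≡ 8 → ∀ v → ((S v ≡ true) × InC xs ys v) ⇔ (v ≡ xs j ⊎ v ≡ xs (sucMod (sucMod j))))
  almost-full-y y y∉C jF y≁j only-j =
    trans (cong S (sym (cong xs (idx-toℕ jF)))) S-j , trans countC-S S-count≡2 , +-mono-≤ m≤4 m≤4 , S-on-C ∘ m+m≡8⇒m≡4
    where open AlmostFull y y∉C jF y≁j only-j

  module AdjacentPair (x : Fin n) (x∉C : ¬ InC xs ys x) (Sx : S x ≡ true)
    (y : Fin n) (y∉C : ¬ InC xs ys y) (y∈Y : side y ≡ false) (x~y : adj G x y ≡ true) where

    x≢y : x ≢ y
    x≢y x≡y = true≢false (trans (sym (S⊆X x Sx)) (trans (cong side x≡y) y∈Y))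

    module FromNeighbour (b : ℕ) (x~b : adj G x (yAt b) ≡ true) where

      pos : ℕ → ℕ
      pos i = b + 1 + i

      y~at : ℕ → Bool
      y~at i = adj G y (xAt (pos i))

      S-at : ℕ → Bool
      S-at i = S (xAt (pos i))

      b<pos : ∀ i → b < pos i
      b<pos i = <-≤-trans (m<m+n b z<s) (m≤m+n (b + 1) i)

      pos≤b+m : ∀ i → i < m → pos i ≤ b + m
      pos≤b+m i i<m = subst (_≤ b + m) (sym (reassoc b i)) (+-monoʳ-≤ b i<m)
        where
        reassoc : ∀ b i → b + 1 + i ≡ b + suc i
        reassoc = solve-∀

      early-neighbour-excludes-S : ∀ i s → i + 3 ≤ m → s ≤ i → y~at i ≡ true → S-at s ≡ true → ⊥
      early-neighbour-excludes-S i s short s≤i y~i Ss =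
        edge-chord-xy-excludes-S x y x∉C y∉C x≢y x~y Sx (pos i) b (b<pos i) short′ x~b y~i
          (pos s) (b<pos s) (+-monoʳ-≤ (b + 1) s≤i) Ss
        where
        reassoc : ∀ b i → b + 1 + i + 2 ≡ b + (i + 3)
        reassoc = solve-∀
        short′ : pos i + 2 ≤ b + m
        short′ = subst (_≤ b + m) (sym (reassoc b i)) (+-monoʳ-≤ b short)

      late-neighbour-excludes-S : ∀ i s → 2 ≤ i → i ≤ s → s < m → y~at i ≡ true → S-at s ≡ true → ⊥
      late-neighbour-excludes-S i s 2≤i i≤s s<m y~i Ss =
        edge-chord-yx-excludes-S x y x∉C y∉C x≢y x~y Sx (pos i) (b + m) (pos≤b+m i (<-≤-trans (s≤s i≤s) s<m)) short
          (adj-yAt-+m x b x~b) y~i (pos s) (+-monoʳ-≤ (b + 1) i≤s) (pos≤b+m s s<m) Ss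
        where
        reassoc : ∀ b k → b + k + 3 ≡ b + 1 + 2 + k
        reassoc = solve-∀
        short : b + m + 3 ≤ pos i + m
        short = subst (_≤ pos i + m) (sym (reassoc b m)) (+-monoˡ-≤ m (+-monoʳ-≤ (b + 1) 2≤i))

      neighbours-exclude-two-S : ∀ i i' s s' → i < i' → i' + 2 ≤ i + m → i ≤ s → s < s' → s' ≤ i' →
        y~at i ≡ true → y~at i' ≡ true → S-at s ≡ true → S-at s' ≡ true → ⊥
      neighbours-exclude-two-S i i' s s' i<i' short i≤s s<s' s'≤i' y~i y~i' =
        chord-xx-excludes-two-S y y∉C (pos i) (pos i') (+-monoʳ-< (b + 1) i<i')
          (subst₂ _≤_ (sym (+-assoc (b + 1) i' 2)) (sym (+-assoc (b + 1) i m)) (+-monoʳ-≤ (b + 1) short))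
          y~i y~i' (pos s) (pos s') (+-monoʳ-≤ (b + 1) i≤s) (+-monoʳ-< (b + 1) s<s') (+-monoʳ-≤ (b + 1) s'≤i')

      y-degree-from-b : countBelow y~at m ≡ d-xs y
      y-degree-from-b = countBelow-rotate m (λ i → adj G y (xAt i)) (b + 1) (λ i → cong (adj G y) (xAt-m+ i))

      S-count-from-b : countBelow S-at m ≡ countBelow (S ∘ xAt) m
      S-count-from-b = countBelow-rotate m (S ∘ xAt) (b + 1) (λ i → cong S (xAt-m+ i))

      y-degree≤2 : 4 ≤ m → countBelow y~at m ≤ 2
      y-degree≤2 4≤m = ≤-pred (≰⇒> no-three)
        where
        no-three : ¬ (3 ≤ countBelow y~at m)
        no-three three with three-witnesses m y~at three | two-witnesses m S-at (subst (2 ≤_) (sym S-count-from-b) two)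
        ... | i₁ , i₂ , i₃ , i₁<i₂ , i₂<i₃ , i₃<m , y₁ , y₂ , y₃ | s₁ , s₂ , s₁<s₂ , s₂<m , S₁ , S₂ = split (2 ≤? i₁)
          where
          early : ∀ i → i ≤ 1 → i + 3 ≤ m
          early i i≤1 = ≤-trans (+-monoˡ-≤ 3 i≤1) 4≤m
          2≤i₃ : 2 ≤ i₃
          2≤i₃ = ≤-trans (m≤n+m 2 i₁) (m<n<o⇒m+2≤o i₁<i₂ i₂<i₃)
          i₁+3≤m : i₁ + 3 ≤ m
          i₁+3≤m = ≤-trans (≤-reflexive (+-suc i₁ 2)) (≤-trans (s≤s (m<n<o⇒m+2≤o i₁<i₂ i₂<i₃)) i₃<m)
          s₁-after-i₁ : i₁ < s₁ → Dec (2 ≤ i₂) → ⊥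
          s₁-after-i₁ i₁<s₁ (no 2≰i₂) with s₁ ≤? i₂ | i₃ ≤? s₂
          ... | yes s₁≤i₂ | _         = early-neighbour-excludes-S i₂ s₁ (early i₂ (≤-pred (≰⇒> 2≰i₂))) s₁≤i₂ y₂ S₁
          ... | no  _     | yes i₃≤s₂ = late-neighbour-excludes-S i₃ s₂ 2≤i₃ i₃≤s₂ s₂<m y₃ S₂
          ... | no  s₁≰i₂ | no  i₃≰s₂ =
            neighbours-exclude-two-S i₂ i₃ s₁ s₂ i₂<i₃ (m<n⇒m+2≤o+n i₃<m (≤-trans (s≤s z≤n) i₁<i₂))
              (<⇒≤ (≰⇒> s₁≰i₂)) s₁<s₂ (<⇒≤ (≰⇒> i₃≰s₂)) y₂ y₃ S₁ S₂
          s₁-after-i₁ i₁<s₁ (yes 2≤i₂) with i₂ ≤? s₂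
          ... | yes i₂≤s₂ = late-neighbour-excludes-S i₂ s₂ 2≤i₂ i₂≤s₂ s₂<m y₂ S₂
          ... | no  i₂≰s₂ =
            neighbours-exclude-two-S i₁ i₂ s₁ s₂ i₁<i₂ (≤-trans (m<n<o⇒m+2≤o i₂<i₃ i₃<m) (m≤n+m m i₁))
              (<⇒≤ i₁<s₁) s₁<s₂ (<⇒≤ (≰⇒> i₂≰s₂)) y₁ y₂ S₁ S₂
          split : Dec (2 ≤ i₁) → ⊥
          split (no 2≰i₁) with s₁ ≤? i₁
          ... | yes s₁≤i₁ = early-neighbour-excludes-S i₁ s₁ (early i₁ (≤-pred (≰⇒> 2≰i₁))) s₁≤i₁ y₁ S₁
          ... | no  s₁≰i₁ = s₁-after-i₁ (≰⇒> s₁≰i₁) (2 ≤? i₂)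
          split (yes 2≤i₁) with i₁ ≤? s₂
          ... | yes i₁≤s₂ = late-neighbour-excludes-S i₁ s₂ 2≤i₁ i₁≤s₂ s₂<m y₁ S₂
          ... | no  i₁≰s₂ = early-neighbour-excludes-S i₁ s₁ i₁+3≤m (<⇒≤ (<-trans s₁<s₂ (≰⇒> i₁≰s₂))) y₁ S₁

      y-degree≤1 : m ≡ 3 → adj G x (yAt (b + 1)) ≡ true → countBelow y~at m ≤ 1
      y-degree≤1 m≡3 x~b+1 = ≤-pred (≰⇒> no-two)
        where
        b+1<pos1 : b + 1 < pos 1
        b+1<pos1 = m<m+n (b + 1) z<s
        S-at-0-excluded : S-at 0 ≡ true → ⊥
        S-at-0-excluded S₀ = S-chord-yy-excludes-S x x∉C Sx b (b + 1) (m<m+n b z<s)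
          (subst (λ k → b + 1 + 2 ≤ b + k) (sym m≡3) (≤-reflexive (+-assoc b 1 2))) x~b x~b+1
          (b + 1) (m<m+n b z<s) ≤-refl (subst (λ z → S (xAt z) ≡ true) (+-identityʳ (b + 1)) S₀)
        excluded : ∀ s₁ s₂ i₁ i₂ → s₁ < s₂ → s₂ < 3 → i₁ < i₂ → i₂ < 3 →
          S-at s₁ ≡ true → S-at s₂ ≡ true → y~at i₂ ≡ true → ⊥
        excluded zero _ _ _ _ _ _ _ S₁ _ _ = S-at-0-excluded S₁
        excluded 1 2 _ 2 _ _ _ _ _ S₂ y₂ = late-neighbour-excludes-S 2 2 ≤-refl ≤-refl (subst (2 <_) (sym m≡3) ≤-refl) y₂ S₂
        excluded 1 2 _ 1 _ _ _ _ S₁ _ y₁ =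
          edge-chord-xy-excludes-S x y x∉C y∉C x≢y x~y Sx (pos 1) (b + 1) b+1<pos1
            (subst (λ k → pos 1 + 2 ≤ b + 1 + k) (sym m≡3) (≤-reflexive (+-assoc (b + 1) 1 2))) x~b+1 y₁
            (pos 1) b+1<pos1 ≤-refl S₁
        excluded 1 2 _ zero _ _ () _ _ _ _
        excluded 1 (suc (suc (suc _))) _ _ _ (s≤s (s≤s (s≤s ()))) _ _ _ _ _
        excluded _ _ _ (suc (suc (suc _))) _ _ _ (s≤s (s≤s (s≤s ()))) _ _ _
        excluded 1 1 _ _ (s≤s ()) _ _ _ _ _ _
        excluded 1 zero _ _ () _ _ _ _ _ _
        excluded (suc (suc s₁)) s₂ _ _ s₁<s₂ s₂<3 _ _ _ _ _ = 4≰3 (≤-trans (s≤s (≤-trans (s≤s (s≤s (s≤s z≤n))) s₁<s₂)) s₂<3)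
          where
          4≰3 : ¬ (4 ≤ 3)
          4≰3 (s≤s (s≤s (s≤s ())))
        no-two : ¬ (2 ≤ countBelow y~at m)
        no-two two-y with two-witnesses m y~at two-y | two-witnesses m S-at (subst (2 ≤_) (sym S-count-from-b) two)
        ... | i₁ , i₂ , i₁<i₂ , i₂<m , _ , y₂ | s₁ , s₂ , s₁<s₂ , s₂<m , S₁ , S₂ =
          excluded s₁ s₂ i₁ i₂ s₁<s₂ (subst (s₂ <_) m≡3 s₂<m) i₁<i₂ (subst (i₂ <_) m≡3 i₂<m) S₁ S₂ y₂

    consecutive-x-neighbours : m ≡ 3 → 2 ≤ d-ys x → Σ ℕ λ b → adj G x (yAt b) ≡ true × adj G x (yAt (b + 1)) ≡ true
    consecutive-x-neighbours m≡3 two-x with two-witnesses m (λ i → adj G x (yAt i)) two-x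
    ... | b₁ , b₂ , b₁<b₂ , b₂<m , x~b₁ , x~b₂ = pick b₁ b₂ b₁<b₂ (subst (b₂ <_) m≡3 b₂<m) x~b₁ x~b₂
      where
      pick : ∀ b₁ b₂ → b₁ < b₂ → b₂ < 3 → adj G x (yAt b₁) ≡ true → adj G x (yAt b₂) ≡ true →
        Σ ℕ λ b → adj G x (yAt b) ≡ true × adj G x (yAt (b + 1)) ≡ true
      pick 0 1 _ _ x~0 x~1 = 0 , x~0 , x~1
      pick 1 2 _ _ x~1 x~2 = 1 , x~1 , x~2
      pick 0 2 _ _ x~0 x~2 = 2 , x~2 , subst (λ k → adj G x (yAt k) ≡ true) m≡3 (adj-yAt-+m x 0 x~0)
      pick _ (suc (suc (suc _))) _ (s≤s (s≤s (s≤s ()))) _ _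
      pick 0 0 () _ _ _
      pick 1 0 () _ _ _
      pick 1 1 (s≤s ()) _ _ _
      pick (suc (suc _)) 0 () _ _ _
      pick (suc (suc _)) 1 (s≤s ()) _ _ _
      pick (suc (suc _)) 2 (s≤s (s≤s ())) _ _ _

    edge-degree-bounds-m≡3 : m ≡ 3 → d-ys x ≢ 0 → Dec (d-ys x ≡ 1) → (d-ys x + d-xs y ≤ 4) × (d-ys x + d-xs y ≤ m)
    edge-degree-bounds-m≡3 m≡3 dx≢0 (yes dx≡1) = ≤-trans sum≤m (subst (_≤ 4) (sym m≡3) (n≤1+n 3)) , sum≤m
      where
      sum≤m : d-ys x + d-xs y ≤ m
      sum≤m = subst (λ d → d + d-xs y ≤ m) (sym dx≡1) (subst (_≤ m) (+-comm (d-xs y) 1) (y-degree<m y y∉C))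
    edge-degree-bounds-m≡3 m≡3 dx≢0 (no dx≢1) = ≤-trans sum≤3 (n≤1+n 3) , subst (d-ys x + d-xs y ≤_) (sym m≡3) sum≤3
      where
      dx≡2 : d-ys x ≡ 2
      dx≡2 = ≤-antisym (x-degree≤2 x x∉C Sx) (≤∧≢⇒< (≤∧≢⇒< z≤n (dx≢0 ∘ sym)) (dx≢1 ∘ sym))
      dy≤1 : d-xs y ≤ 1
      dy≤1 = consecutive⇒dy≤1 (consecutive-x-neighbours m≡3 (≤-reflexive (sym dx≡2)))
        where
        consecutive⇒dy≤1 : (Σ ℕ λ b → adj G x (yAt b) ≡ true × adj G x (yAt (b + 1)) ≡ true) → d-xs y ≤ 1
        consecutive⇒dy≤1 (b , x~b , x~b+1) =
          subst (_≤ 1) (FromNeighbour.y-degree-from-b b x~b) (FromNeighbour.y-degree≤1 b x~b m≡3 x~b+1)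
      sum≤3 : d-ys x + d-xs y ≤ 3
      sum≤3 = subst (λ d → d + d-xs y ≤ 3) (sym dx≡2) (+-monoʳ-≤ 2 dy≤1)

    -- A neighbour y_b of x leaves y at most two neighbours on C, and at most one
    -- when m = 3 and x has two (necessarily consecutive) neighbours.
    edge-degree-bounds′ : Dec (d-ys x ≡ 0) → (d-ys x + d-xs y ≤ 4) × (d-ys x + d-xs y ≤ m)
    edge-degree-bounds′ (yes dx≡0) = subst (λ d → d + d-xs y ≤ 4) (sym dx≡0) (y-degree≤4 y y∉C)
                   , subst (λ d → d + d-xs y ≤ m) (sym dx≡0) (≤-trans (m≤m+n (d-xs y) 1) (y-degree<m y y∉C))
    edge-degree-bounds′ (no dx≢0) with countBelow-last m (λ i → adj G x (yAt i)) 0 (n≢0⇒n>0 dx≢0) | 4 ≤? m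
    ...   | b , _ , x~b , _ | yes 4≤m = sum≤4 , ≤-trans sum≤4 4≤m
      where
      sum≤4 : d-ys x + d-xs y ≤ 4
      sum≤4 = +-mono-≤ (x-degree≤2 x x∉C Sx)
        (subst (_≤ 2) (FromNeighbour.y-degree-from-b b x~b) (FromNeighbour.y-degree≤2 b x~b 4≤m))
    ...   | _ | no 4≰m = edge-degree-bounds-m≡3 (≤-antisym (≤-pred (≰⇒> 4≰m)) 3≤m) dx≢0 (d-ys x ≟ 1)

    edge-degree-bounds : (d-ys x + d-xs y ≤ 4) × (d-ys x + d-xs y ≤ m)
    edge-degree-bounds = edge-degree-bounds′ (d-ys x ≟ 0)

  S-count-walkFrom : ∀ k o → countBelow (S ∘ walkFrom o) (k + k) ≡ countBelow (λ i → S (xAt (o + i))) k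
  S-count-walkFrom zero    o = refl
  S-count-walkFrom (suc k) o = begin
    countBelow (S ∘ walkFrom o) (suc (k + suc k))
      ≡⟨ cong (λ l → countBelow (S ∘ walkFrom o) (suc l)) (+-suc k k) ⟩
    bit (S (xAt o)) + (bit (S (yAt o)) + countBelow (S ∘ walkFrom (suc o)) (k + k))
      ≡⟨ cong₂ (λ u b → bit (S u) + (bit b + countBelow (S ∘ walkFrom (suc o)) (k + k))) (cong xAt (sym (+-identityʳ o))) (yAt∉S o) ⟩
    bit (S (xAt (o + 0))) + countBelow (S ∘ walkFrom (suc o)) (k + k)
      ≡⟨ cong (bit (S (xAt (o + 0))) +_)
           (trans (S-count-walkFrom k (suc o)) (countBelow-cong k (λ i _ → cong (S ∘ xAt) (sym (+-suc o i))))) ⟩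
    countBelow (λ i → S (xAt (o + i))) (suc k) ∎
    where open ≡-Reasoning

  module Reroute (i : ℕ) (i<m : i < m) (y : Fin n) (y∉C : ¬ InC xs ys y) (y∉S : S y ≡ false)
    (y~i : adj G y (xAt i) ≡ true) (y~i+1 : adj G y (xAt (suc i)) ≡ true) where

    q : ℕ
    q = suc (i + i)

    q<2m : q < m + m
    q<2m = subst (_≤ m + m) (cong suc (+-suc i i)) (+-mono-≤ i<m i<m)

    rerouted : ℕ → Fin n
    rerouted r with r ≟ q
    ... | yes _ = y
    ... | no  _ = walk r

    at-q-or-walk : ∀ r → (r ≡ q × rerouted r ≡ y) ⊎ (r ≢ q × rerouted r ≡ walk r)
    at-q-or-walk r with r ≟ q
    ... | yes r≡q = inj₁ (r≡q , refl)
    ... | no  r≢q = inj₂ (r≢q , refl)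

    rerouted-inj : ∀ r r' → r < m + m → r' < m + m → rerouted r ≡ rerouted r' → r ≡ r'
    rerouted-inj r r' r< r'< e with at-q-or-walk r | at-q-or-walk r'
    ... | inj₁ (r≡q , _)  | inj₁ (r'≡q , _)  = trans r≡q (sym r'≡q)
    ... | inj₁ (_ , at-r) | inj₂ (_ , at-r') = ⊥-elim (walk-avoids y y∉C r' (sym (trans (sym at-r) (trans e at-r'))))
    ... | inj₂ (_ , at-r) | inj₁ (_ , at-r') = ⊥-elim (walk-avoids y y∉C r (trans (sym at-r) (trans e at-r')))
    ... | inj₂ (_ , at-r) | inj₂ (_ , at-r') = walk-injective-< r r' r< r'< (trans (sym at-r) (trans e at-r'))

    step : ∀ r → suc r < m + m → adj G (rerouted r) (rerouted (suc r)) ≡ true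
    step r _ with at-q-or-walk r | at-q-or-walk (suc r)
    ... | inj₁ (refl , _)    | inj₁ (q+1≡q , _) = ⊥-elim (<-irrefl (sym q+1≡q) (n<1+n q))
    ... | inj₁ (refl , at-r) | inj₂ (_ , at-r') =
      subst₂ (λ u v → adj G u v ≡ true) (sym at-r) (sym (trans at-r' (walkFrom-even 1 i))) y~i+1
    ... | inj₂ (_ , at-r)    | inj₁ (r+1≡q , at-r') =
      subst₂ (λ u v → adj G u v ≡ true) (sym (trans at-r (trans (cong (walk ∘ pred) r+1≡q) (walk-even i)))) (sym at-r')
        (trans (adj-sym G _ _) y~i)
    ... | inj₂ (_ , at-r)    | inj₂ (_ , at-r') = subst₂ (λ u v → adj G u v ≡ true) (sym at-r) (sym at-r') (walk-adjacent r)

    rerouted-0 : rerouted 0 ≡ walk 0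
    rerouted-0 with at-q-or-walk 0
    ... | inj₁ (() , _)
    ... | inj₂ (_ , at-0) = at-0

    close : adj G (rerouted (M + m)) (rerouted 0) ≡ true
    close with at-q-or-walk (M + m)
    ... | inj₁ (last≡q , at-last) = subst₂ (λ u v → adj G u v ≡ true) (sym at-last) (sym rerouted-0)
      (subst (λ z → adj G y z ≡ true) (trans (cong xAt (cong suc i≡M)) (xAt-+m 0)) y~i+1)
      where
      M+M≡i+i : M + M ≡ i + i
      M+M≡i+i = cong pred (trans (sym (+-suc M M)) last≡q)
      i≡M : i ≡ M
      i≡M = ≤-antisym (double-cancel-≤ i M (≤-reflexive (sym M+M≡i+i))) (double-cancel-≤ M i (≤-reflexive M+M≡i+i))
    ... | inj₂ (_ , at-last) = subst₂ (λ u v → adj G u v ≡ true) (sym at-last) (sym rerouted-0)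
      (subst (λ z → adj G (walk (M + m)) z ≡ true) (walk-periodic 0) (walk-adjacent (M + m)))

    rerouted-isCycle : IsCycle G (m + m) (λ t → rerouted (toℕ t))
    rerouted-isCycle = isCycle-fromℕ G (m + m) rerouted (≤-trans 3≤m (m≤m+n m m)) rerouted-inj step close

    rerouted-S-count : countOn S (λ (t : Fin (m + m)) → rerouted (toℕ t)) ≡ countC S xs ys
    rerouted-S-count = trans (countOn-fromℕ S (m + m) rerouted)
      (trans (countBelow-cong (m + m) same-S) (trans (S-count-walkFrom m 0) (sym countC-S)))
      where
      same-S : ∀ r → r < m + m → S (rerouted r) ≡ S (walk r)
      same-S r _ with at-q-or-walk r
      ... | inj₁ (refl , at-q) = trans (cong S at-q) (trans y∉S (sym (trans (cong S (walk-odd i)) (yAt∉S i))))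
      ... | inj₂ (_ , at-r) = cong S at-r

    rerouted-within : ∀ r → rerouted r ≡ y ⊎ InC xs ys (rerouted r)
    rerouted-within r with at-q-or-walk r
    ... | inj₁ (_ , at-q) = inj₁ at-q
    ... | inj₂ (_ , at-r) = inj₂ (subst (InC xs ys) (sym at-r) (walk-inC r))

    rerouted-avoids : ∀ v → ¬ InC xs ys v → v ≢ y → ∀ r → rerouted r ≢ v
    rerouted-avoids v v∉C v≢y r e with at-q-or-walk r
    ... | inj₁ (_ , at-q) = v≢y (trans (sym e) at-q)
    ... | inj₂ (_ , at-r) = walk-avoids v v∉C r (trans (sym at-r) e)

    rerouted-avoids-yᵢ : ∀ r → r < m + m → rerouted r ≢ yAt i
    rerouted-avoids-yᵢ r r< e with at-q-or-walk r
    ... | inj₁ (_ , at-q)   = y∉C (inj₂ (idx i , trans (sym e) at-q))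
    ... | inj₂ (r≢q , at-r) = r≢q (walk-injective-< r q r< q<2m (trans (sym at-r) (trans e (sym (walk-odd i)))))

  module LargeDegreeSum (x : Fin n) (x∉C : ¬ InC xs ys x) (Sx : S x ≡ true)
    (y : Fin n) (y∉C : ¬ InC xs ys y) (y∈Y : side y ≡ false) (large : m + 1 ≤ d-ys x + d-xs y) where

    x≁y : adj G x y ≡ false
    x≁y with adj G x y in x~y
    ... | true  = ⊥-elim (<-irrefl refl (subst (_≤ m) (+-comm m 1)
                    (≤-trans large (proj₂ (AdjacentPair.edge-degree-bounds x x∉C Sx y y∉C y∈Y x~y)))))
    ... | false = refl

    y~x : ℕ → Bool
    y~x i = adj G y (xAt i)

    one-non-neighbour : countBelow (not ∘ y~x) m ≡ 1
    one-non-neighbour = ≤-antisym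
      (+-cancelˡ-≤ (d-xs y) _ 1 (+-cancelʳ-≤ 2 _ _ (begin
        d-xs y + countBelow (not ∘ y~x) m + 2  ≡⟨ cong (_+ 2) (countBelow-not m y~x) ⟩
        m + 2                                   ≡⟨ reassoc₁ m ⟩
        1 + (m + 1)                             ≤⟨ +-monoʳ-≤ 1 large ⟩
        1 + (d-ys x + d-xs y)                   ≤⟨ +-monoʳ-≤ 1 (+-monoˡ-≤ (d-xs y) (x-degree≤2 x x∉C Sx)) ⟩
        1 + (2 + d-xs y)                        ≡⟨ reassoc₂ (d-xs y) ⟩
        d-xs y + 1 + 2                          ∎)))
      (+-cancelˡ-≤ (d-xs y) 1 _ (subst (d-xs y + 1 ≤_) (sym (countBelow-not m y~x)) (y-degree<m y y∉C)))
      where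
      open ≤-Reasoning
      reassoc₁ : ∀ k → k + 2 ≡ 1 + (k + 1)
      reassoc₁ = solve-∀
      reassoc₂ : ∀ d → 1 + (2 + d) ≡ d + 1 + 2
      reassoc₂ = solve-∀

    2≤x-degree : 2 ≤ d-ys x
    2≤x-degree = +-cancelʳ-≤ (d-xs y) 2 (d-ys x) (begin
      2 + d-xs y      ≡⟨ +-comm 2 (d-xs y) ⟩
      d-xs y + 2      ≡⟨ +-assoc (d-xs y) 1 1 ⟨
      d-xs y + 1 + 1  ≤⟨ +-monoˡ-≤ 1 (y-degree<m y y∉C) ⟩
      m + 1           ≤⟨ large ⟩
      d-ys x + d-xs y ∎)
      where open ≤-Reasoning

    non-neighbour : Σ ℕ λ j → j < m × y~x j ≡ false
    non-neighbour with countBelow-last m (not ∘ y~x) 0 (≤-reflexive (sym one-non-neighbour))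
    ... | j , j<m , y≁j , _ = j , j<m , not-injective y≁j

    j : ℕ
    j = proj₁ non-neighbour

    j<m : j < m
    j<m = proj₁ (proj₂ non-neighbour)

    y≁j : y~x j ≡ false
    y≁j = proj₂ (proj₂ non-neighbour)

    y~others : ∀ i → i < m → i ≢ j → y~x i ≡ true
    y~others i i<m i≢j = ¬-not λ y≁i → i≢j
      (countBelow≤1-unique m (not ∘ y~x) (≤-reflexive one-non-neighbour) i j i<m j<m (cong not y≁i) (cong not y≁j))

    y~mod : ∀ i → i % m ≢ j → y~x i ≡ true
    y~mod i i≢j = trans (cong (adj G y ∘ xs) (idx-cong-% i (i % m) (sym (m%n%n≡m%n i m)))) (y~others (i % m) (m%n<n i m) i≢j)

    only-j : ∀ iF → adj G y (xs iF) ≡ false → iF ≡ idx j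
    only-j iF y≁iF = trans (sym (idx-toℕ iF)) (cong idx (countBelow≤1-unique m (not ∘ y~x) (≤-reflexive one-non-neighbour)
      (toℕ iF) j (toℕ<n iF) j<m (cong not (trans (cong (adj G y ∘ xs) (idx-toℕ iF)) y≁iF)) (cong not y≁j)))

    S-j : S (xAt j) ≡ true
    S-j = subst (λ k → S (xAt k) ≡ true) (trans (toℕ-idx j) (m<n⇒m%n≡m j<m)) (AlmostFull.S-j y y∉C (idx j) y≁j only-j)

    GoodIndex : Set
    GoodIndex = Σ ℕ λ i → i < m × adj G x (yAt i) ≡ true × y~x i ≡ true × y~x (suc i) ≡ true

    NearJ : ℕ → Set
    NearJ b = b ≡ j ⊎ suc b % m ≡ j

    good-or-near-j : ∀ b → b < m → adj G x (yAt b) ≡ true → Dec (b ≡ j) → Dec (suc b % m ≡ j) → GoodIndex ⊎ NearJ b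
    good-or-near-j b b<m x~b (yes b≡j) _            = inj₂ (inj₁ b≡j)
    good-or-near-j b b<m x~b (no  _)   (yes b+1≡j) = inj₂ (inj₂ b+1≡j)
    good-or-near-j b b<m x~b (no  b≢j) (no  b+1≢j) =
      inj₁ (b , b<m , x~b , y~mod b (λ e → b≢j (trans (sym (m<n⇒m%n≡m b<m)) e)) , y~mod (suc b) b+1≢j)

    -- x has two neighbours y_b₁, y_b₂; if neither is good, both are next to x_j ∈ S and
    -- x would see x_j through a short chord.
    two-near-j-impossible : ∀ b₁ b₂ → b₁ < b₂ → b₂ < m → adj G x (yAt b₁) ≡ true → adj G x (yAt b₂) ≡ true →
      NearJ b₁ → NearJ b₂ → ⊥
    two-near-j-impossible b₁ b₂ b₁<b₂ b₂<m _ _ (inj₁ b₁≡j) (inj₁ b₂≡j) = <-irrefl (trans b₁≡j (sym b₂≡j)) b₁<b₂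
    two-near-j-impossible b₁ b₂ b₁<b₂ b₂<m x~b₁ x~b₂ (inj₁ b₁≡j) (inj₂ b₂+1≡j) =
      wrapped-S-chord-yy-excludes-S x x∉C Sx b₂ b₁ b₁+2≤b₂ b₂<m x~b₂ x~b₁
        (b₁ + m) (≤-trans b₂<m (m≤n+m m b₁)) ≤-refl (S-xAt-+m b₁ (subst (λ k → S (xAt k) ≡ true) (sym b₁≡j) S-j))
      where
      b₁+m≤b₂+1 : b₁ + m ≤ suc b₂
      b₁+m≤b₂+1 = ≮⇒≥ λ b₂+1<b₁+m → <-irrefl
        (%-window-injective m b₁ (suc b₂) (trans (m<n⇒m%n≡m (<-trans b₁<b₂ b₂<m)) (trans b₁≡j (sym b₂+1≡j)))
          (<⇒≤ (<-trans b₁<b₂ (n<1+n b₂))) b₂+1<b₁+m)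
        (<-trans b₁<b₂ (n<1+n b₂))
      b₁+2≤b₂ : b₁ + 2 ≤ b₂
      b₁+2≤b₂ = ≤-pred (subst (_≤ suc b₂) (+-suc b₁ 2) (≤-trans (+-monoʳ-≤ b₁ 3≤m) b₁+m≤b₂+1))
    two-near-j-impossible b₁ b₂ b₁<b₂ b₂<m x~b₁ x~b₂ (inj₂ b₁+1≡j) (inj₁ b₂≡j) =
      S-chord-yy-excludes-S x x∉C Sx b₁ b₂ b₁<b₂ short x~b₁ x~b₂ b₂ b₁<b₂ ≤-refl (subst (λ k → S (xAt k) ≡ true) (sym b₂≡j) S-j)
      where
      b₁+1≡b₂ : suc b₁ ≡ b₂
      b₁+1≡b₂ = trans (sym (m<n⇒m%n≡m (≤-trans (s≤s b₁<b₂) b₂<m))) (trans b₁+1≡j (sym b₂≡j))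
      short : b₂ + 2 ≤ b₁ + m
      short = subst (λ k → k + 2 ≤ b₁ + m) b₁+1≡b₂ (subst (_≤ b₁ + m) (+-suc b₁ 2) (+-monoʳ-≤ b₁ 3≤m))
    two-near-j-impossible b₁ b₂ b₁<b₂ b₂<m _ _ (inj₂ b₁+1≡j) (inj₂ b₂+1≡j) = <-irrefl
      (cong pred (%-window-injective m (suc b₁) (suc b₂) (trans b₁+1≡j (sym b₂+1≡j)) (s≤s (<⇒≤ b₁<b₂))
        (s≤s (≤-trans b₂<m (m≤n+m m b₁)))))
      b₁<b₂

    good-index : GoodIndex
    good-index with two-witnesses m (λ i → adj G x (yAt i)) 2≤x-degree
    ... | b₁ , b₂ , b₁<b₂ , b₂<m , x~b₁ , x~b₂ =
      choose (good-or-near-j b₁ (<-trans b₁<b₂ b₂<m) x~b₁ (b₁ ≟ j) (suc b₁ % m ≟ j))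
             (good-or-near-j b₂ b₂<m x~b₂ (b₂ ≟ j) (suc b₂ % m ≟ j))
      where
      choose : GoodIndex ⊎ NearJ b₁ → GoodIndex ⊎ NearJ b₂ → GoodIndex
      choose (inj₁ good) _           = good
      choose (inj₂ _)    (inj₁ good) = good
      choose (inj₂ near₁) (inj₂ near₂) = ⊥-elim (two-near-j-impossible b₁ b₂ b₁<b₂ b₂<m x~b₁ x~b₂ near₁ near₂)

    RerouteWitness : Set
    RerouteWitness = Σ ℕ (λ k → Σ (Fin k → Fin n) (λ c → Σ (Fin m) (λ i →
      IsCycle G k c
      × (∀ t → c t ≡ x ⊎ c t ≡ y ⊎ InC xs ys (c t))
      × adj G x (ys i) ≡ true
      × (∀ t → c t ≢ x) × (∀ t → c t ≢ ys i)
      × k ≡ m + m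
      × countOn S c ≡ countC S xs ys)))

    reroute-at : GoodIndex → RerouteWitness
    reroute-at (i , i<m , x~i , y~i , y~i+1) =
      m + m , (λ t → rerouted (toℕ t)) , idx i ,
      rerouted-isCycle , (λ t → inj₂ (rerouted-within (toℕ t))) , x~i ,
      (λ t → rerouted-avoids x x∉C x≢y (toℕ t)) , (λ t → rerouted-avoids-yᵢ (toℕ t) (toℕ<n t)) , refl , rerouted-S-count
      where
      open Reroute i i<m y y∉C (Y⇒¬S y y∈Y) y~i y~i+1
      x≢y : x ≢ y
      x≢y x≡y = true≢false (trans (sym (S⊆X x Sx)) (trans (cong side x≡y) y∈Y))

    reroute : RerouteWitness
    reroute = reroute-at good-index


lemma1 : ∀ {n} (G : Graph n) (side : Fin n → Bool) → IsBalancedBipartite G side →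
    (S : Fin n → Bool) → (∀ v → S v ≡ true → side v ≡ true) →
    (m : ℕ) (xs ys : Fin m → Fin n) → IsXYCycle G side m xs ys →
    (x y : Fin n) → ¬ InC xs ys x → ¬ InC xs ys y →
    S x ≡ true → side y ≡ false →
    MinimalSystem G S xs ys →
    ( (dC G xs ys x ≤ 2) × (dC G xs ys y ≤ 4)
    × (adj G x y ≡ true → e2C G xs ys x y ≤ 4) )
    × ( (dC G xs ys y + 1 ≤ m)
    × (dC G xs ys y + 1 ≡ m → (j : Fin m) → adj G y (xs j) ≡ false →
    (∀ i → adj G y (xs i) ≡ false → i ≡ j) →
    (S (xs j) ≡ true) × (countC S xs ys ≡ 2) × (m + m ≤ 8)
    × (m + m ≡ 8 → ∀ v → ((S v ≡ true) × InC xs ys v)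
    ⇔ (v ≡ xs j ⊎ v ≡ xs (sucMod (sucMod j))))) )
    × ( m + 1 ≤ e2C G xs ys x y →
    (adj G x y ≡ false)
    × Σ ℕ (λ k → Σ (Fin k → Fin n) (λ c → Σ (Fin m) (λ i →
    IsCycle G k c
    × (∀ t → c t ≡ x ⊎ c t ≡ y ⊎ InC xs ys (c t))
    × adj G x (ys i) ≡ true
    × (∀ t → c t ≢ x) × (∀ t → c t ≢ ys i)
    × k ≡ m + m
    × countOn S c ≡ countC S xs ys))) )
    × ( adj G x y ≡ true → e2C G xs ys x y ≤ m )
lemma1 G side _ S S⊆X zero xs ys (() , _) x y x∉C y∉C Sx y∈Y _
lemma1 G side (bipartite , _) S S⊆X (suc M) xs ys (3≤m , xs-inj , ys-inj , xs≢ys , xs∈X , ys∈Y , xy-edge , yx-edge)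
       x y x∉C y∉C Sx y∈Y (two-S , minimal) =
    (dC-x≤2 , subst (_≤ 4) (sym (dC-Y y y∈Y)) (y-degree≤4 y y∉C) , proj₁ ∘ edge-sum-bounds)
  , (subst (λ d → d + 1 ≤ m) (sym (dC-Y y y∈Y)) (y-degree<m y y∉C) , λ _ → almost-full-y y y∉C)
  , (λ large → let open LargeDegreeSum x x∉C Sx y y∉C y∈Y (subst (m + 1 ≤_) e2C≡ large) in x≁y , reroute)
  , proj₂ ∘ edge-sum-bounds
  where
  open MinimalCycle G side bipartite S S⊆X M 3≤m xs ys xs-inj ys-inj xs≢ys xs∈X ys∈Y xy-edge yx-edge two-S minimal
  dC-x≤2 : dC G xs ys x ≤ 2
  dC-x≤2 = subst (_≤ 2) (sym (dC-X x (S⊆X x Sx))) (x-degree≤2 x x∉C Sx)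
  e2C≡ : e2C G xs ys x y ≡ d-ys x + d-xs y
  e2C≡ = cong₂ _+_ (dC-X x (S⊆X x Sx)) (dC-Y y y∈Y)
  edge-sum-bounds : adj G x y ≡ true → (e2C G xs ys x y ≤ 4) × (e2C G xs ys x y ≤ m)
  edge-sum-bounds x~y = subst (λ e → (e ≤ 4) × (e ≤ m)) (sym e2C≡) (AdjacentPair.edge-degree-bounds x x∉C Sx y y∉C y∈Y x~y)
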